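{- Let $n\ge1$ and $1\le m\le n$. Let $x_{ij}=x_{ji}$ ($1\le i,j\le n$) be symmetric indeterminates (independent variables $x_{ij}$, $i\le j$) and $y_{ij}=y_{ji}$ further symmetric indeterminates commuting with them, and put $\Sigma_{ij}=\sum_{k=1}^n(1+\delta_{jk})x_{ik}y_{jk}$. Then, as differential operators on $\mathbb{C}[x_{ij}]$, $$\sum_{(\sigma,\varphi)\in\mathcal{C}^{m+1}}(-1)^{\sigma}\Sigma(\sigma,\varphi,m+1)=\sum_{(\sigma,\varphi)\in\mathcal{C}^{m}}(-1)^{\sigma}\Sigma(\sigma,\varphi,m),$$ where $(-1)^\sigma$ is the sign of $\sigma$.
   Context: A Capelli configuration is a pair $(\sigma,\varphi)$ where $\sigma\in S_n$ and $\varphi$ assigns to each fixed point $i$ of $\sigma$ a number $\varphi(i)\in\{1,\dots,i\}$. For $1\le m\le n+1$, $\mathcal{C}^m$ is the set of Capelli configurations such that whenever $\sigma(k)=k$ and $\varphi(k)<k$, we have $k\ge m$. For a polynomial $F$ in $\{x_{ij}\}\cup\{y_{ij}\}$, $F(\partial)$ is the differential operator on polynomials in the $x_{ij}$ defined linearly by $F(\partial)=G(x)H(\partial/\partial x)$ when $F=G(x)H(y)$, i.e. substitute $y_{ij}\mapsto\partial/\partial x_{ij}$ (the derivative with respect to the variable $x_{ij}=x_{ji}$) and place all derivatives to the right of all multiplications. For a Capelli configuration $(\sigma,\varphi)$, set $\tilde\Sigma_{\sigma(i)i}=\Sigma_{\sigma(i)i}$ if $\sigma(i)\ne i$ or $\varphi(i)=i$,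 and $\tilde\Sigma_{\sigma(i)i}=1$ otherwise; and for $1\le m\le n+1$, $$\Sigma(\sigma,\varphi,m)=\tilde\Sigma_{\sigma(n)n}(\partial)\cdots\tilde\Sigma_{\sigma(m)m}(\partial)\cdot\big(\tilde\Sigma_{\sigma(m-1),m-1}\cdots\tilde\Sigma_{\sigma(1)1}\big)(\partial),$$ where the first factors are composed as operators and the last is $F(\partial)$ for the commutative product $F=\tilde\Sigma_{\sigma(m-1),m-1}\cdots\tilde\Sigma_{\sigma(1)1}$. -}

module Defs where

open import Level using (Level)
open import Data.Bool using (Bool; true; false; if_then_else_; _∧_; _∨_; not)
open import Data.Nat as ℕ using (ℕ; zero; suc)
open import Data.Fin as F using (Fin; toℕ)
open import Data.Fin.Properties using () renaming (_≟_ to _≟F_)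
open import Data.Nat.ListAction as NL using ()
open import Data.Vec as V using (Vec; lookup; updateAt)
open import Data.List as L using (List; []; _∷_; map; concatMap; filterᵇ; foldr; foldl; allFin)
open import Data.Product using (_×_; _,_; ∃)
open import Relation.Nullary using (¬_)
open import Relation.Nullary.Decidable using (⌊_⌋)
open import Relation.Binary.PropositionalEquality using (_≡_)
open import Algebra.Bundles using (CommutativeRing)

-- Indices are 0-based: paper index i ∈ {1..n} is (i₀ : Fin n) with
-- i = toℕ i₀ + 1.

-- Monomials in the symmetric variables x_{ij} (i ≤ j): an exponent
-- matrix; only entries (a , b) with toℕ a ≤ toℕ b are used (see Upper).
Mon : ℕ → Set
Mon n = Vec (Vec ℕ n) n

expo : ∀ {n} → Mon n → Fin n → Fin n → ℕ
expo e a b = lookup (lookup e a) b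

updExp : ∀ {n} → Mon n → Fin n → Fin n → (ℕ → ℕ) → Mon n
updExp e a b g = updateAt e a (λ row → updateAt row b g)

-- canonical representative (min , max) of the variable x_{ij} = x_{ji}
canon : ∀ {n} → Fin n → Fin n → Fin n × Fin n
canon i j = if ⌊ toℕ i ℕ.≤? toℕ j ⌋ then (i , j) else (j , i)

degree : ∀ {n} → Mon n → ℕ
degree e = V.sum (V.map V.sum e)

Upper : ∀ {n} → Mon n → Set
Upper {n} e = (i j : Fin n) → toℕ j ℕ.< toℕ i → expo e i j ≡ 0

vecsOf : ∀ {a} {A : Set a} → List A → (k : ℕ) → List (Vec A k)
vecsOf xs zero = V.[] ∷ []
vecsOf xs (suc k) = concatMap (λ x → map (x V.∷_) (vecsOf xs k)) xs

allB : ∀ {n} → (Fin n → Bool) → Bool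
allB {n} p = foldr (λ i acc → p i ∧ acc) true (allFin n)

countB : ∀ {n} → (Fin n → Bool) → ℕ
countB {n} p = foldr (λ i acc → if p i then suc acc else acc) 0 (allFin n)

eqF : ∀ {n} → Fin n → Fin n → Bool
eqF i j = ⌊ i ≟F j ⌋

ltF : ∀ {n} → Fin n → Fin n → Bool
ltF i j = ⌊ toℕ i ℕ.<? toℕ j ⌋

isPerm : ∀ {n} → Vec (Fin n) n → Bool
isPerm σ = allB (λ i → allB (λ j → not (eqF (lookup σ i) (lookup σ j)) ∨ eqF i j))

inversions : ∀ {n} → Vec (Fin n) n → ℕ
inversions σ = NL.sum (map (λ i → countB (λ j → ltF i j ∧ ltF (lookup σ j) (lookup σ i))) (allFin _))

-- Capelli configurations.  σ is given by its vector of values, φ by a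
-- vector φ₀ with paper value φ(i) = toℕ (φ₀ i) + 1 at fixed points i.
-- At non-fixed points φ is not defined; we force the dummy value 0 there,
-- so valid pairs (σ , φ₀) correspond bijectively to Capelli configurations.

isFixed : ∀ {n} → Vec (Fin n) n → Fin n → Bool
isFixed σ i = eqF (lookup σ i) i

isCapelli : ∀ {n} → Vec (Fin n) n → Vec (Fin n) n → Bool
isCapelli σ φ = isPerm σ ∧ allB (λ i →
  if isFixed σ i then ⌊ toℕ (lookup φ i) ℕ.≤? toℕ i ⌋
                 else (toℕ (lookup φ i) ℕ.≡ᵇ 0))

-- membership in C^m (m is the paper's 1-based m):
-- σ(k) = k and φ(k) < k imply k ≥ m
inCm : ∀ {n} → ℕ → Vec (Fin n) n → Vec (Fin n) n → Bool
inCm m σ φ = allB (λ k →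
  not (isFixed σ k ∧ ltF (lookup φ k) k) ∨ ⌊ m ℕ.≤? suc (toℕ k) ⌋)

-- the factor Σ_{σ(i) i} is kept (not replaced by 1)
keep : ∀ {n} → Vec (Fin n) n → Vec (Fin n) n → Fin n → Bool
keep σ φ i = not (isFixed σ i) ∨ eqF (lookup φ i) i

-- Differential operators on polynomials over R in the x_{ij}.
-- A polynomial is given by its coefficient function Mon n → R.

module _ {c ℓ} (R : CommutativeRing c ℓ) where
  open CommutativeRing R

  Poly : ℕ → Set c
  Poly n = Mon n → Carrier

  IsPoly : ∀ {n} → Poly n → Set ℓ
  IsPoly {n} f = (∃ λ d → (e : Mon n) → d ℕ.< degree e → f e ≈ 0#)
               × ((e : Mon n) → ¬ Upper e → f e ≈ 0#)

  Op : ℕ → Set c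
  Op n = Poly n → Poly n

  natMul : ℕ → Carrier → Carrier
  natMul zero x = 0#
  natMul (suc k) x = x + natMul k x

  sumR : List Carrier → Carrier
  sumR = foldr _+_ 0#

  mulX : ∀ {n} → Fin n → Fin n → Op n
  mulX i j f e with canon i j
  ... | (a , b) with expo e a b
  ...   | zero  = 0#
  ...   | suc _ = f (updExp e a b ℕ.pred)

  dX : ∀ {n} → Fin n → Fin n → Op n
  dX i j f e with canon i j
  ... | (a , b) = natMul (suc (expo e a b)) (f (updExp e a b suc))

  coef : ∀ {n} → Fin n → Fin n → Carrier
  coef j k = if eqF j k then 1# + 1# else 1#

  -- F(∂) for F = Π_{(a,b) ∈ list} Σ_{ab}, Σ_{ab} = Σ_k (1+δ_{bk}) x_{ak} y_{bk}:
  -- expand, substitute y ↦ ∂, all multiplications left of all derivatives.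
  normalOrd : ∀ {n} → List (Fin n × Fin n) → Op n
  normalOrd [] f = f
  normalOrd {n} ((a , b) ∷ fs) f e =
    sumR (map (λ k → coef b k * mulX a k (normalOrd fs (dX b k f)) e) (allFin n))

  SigmaOp : ∀ {n} → Fin n → Fin n → Op n
  SigmaOp a b = normalOrd ((a , b) ∷ [])

  -- Σ(σ,φ,m) = Σ̃_{σ(n)n}(∂) ∘ ⋯ ∘ Σ̃_{σ(m)m}(∂) ∘ (Σ̃_{σ(m-1),m-1} ⋯ Σ̃_{σ(1)1})(∂)
  SigmaConf : ∀ {n} → Vec (Fin n) n → Vec (Fin n) n → ℕ → Op n
  SigmaConf {n} σ φ m =
    foldl (λ acc i → SigmaOp (lookup σ i) i ∘ acc) (normalOrd low) high
    where
    _∘_ : Op n → Op n → Op n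
    (g ∘ h) f = g (h f)
    kept : List (Fin n)
    kept = filterᵇ (keep σ φ) (allFin n)
    -- paper indices i ≥ m, in increasing order (so i = n ends up outermost)
    high : List (Fin n)
    high = filterᵇ (λ i → ⌊ m ℕ.≤? suc (toℕ i) ⌋) kept
    low : List (Fin n × Fin n)
    low = map (λ i → (lookup σ i , i)) (filterᵇ (λ i → ⌊ suc (toℕ i) ℕ.<? m ⌋) kept)

  sign : ∀ {n} → Vec (Fin n) n → Carrier
  sign σ = if (inversions σ ℕ.% 2) ℕ.≡ᵇ 0 then 1# else - 1#

  capelliSum : (n m : ℕ) → Op n
  capelliSum n m f e =
    sumR (concatMap (λ σ → map (λ φ →
      if isCapelli σ φ ∧ inCm m σ φ then sign σ * SigmaConf σ φ m f e else 0#)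
      (vecsOf (allFin n) n)) (vecsOf (allFin n) n))

module Submission where

-- A configuration of C^m either lies in C^(m+1) or is
-- fixed at m with φ(m) < m, so that its factor at m is 1.  In the first case
-- Σ(σ,φ,m) differs from Σ(σ,φ,m+1) only in that Σ_{σ(m)m}(∂) acts after, rather
-- than inside, the normal-ordered product of the factors below m.  Commuting it
-- inside with ∂x = x∂ + δ produces, for every j < m, a term merging the factors
-- at j and m (present when σ(j) = m) and a cross term x_{σ(m)σ(j)} ∂_{jm}.
-- Swapping σ(j) and σ(m) flips the sign of σ: it matches each merged term with a
-- configuration that leaves C^(m+1) with φ(m) = j, and it pairs off the cross
-- terms, which are unchanged since x_{σ(m)σ(j)} = x_{σ(j)σ(m)}.  Hence all
-- correction terms cancel.

open import Defs
open import Algebra.Bundles using (CommutativeRing)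
open import Data.Bool using (Bool; true; false; if_then_else_; _∧_; _∨_; not; _xor_; T)
import Data.Bool.Properties as BP
open import Data.Empty using (⊥-elim)
open import Data.Fin as F using (Fin; toℕ)
open import Data.Fin.Properties using (toℕ-injective; toℕ-fromℕ<) renaming (_≟_ to _≟F_)
open import Data.List as L using (List; []; _∷_; _++_; map; concatMap; filterᵇ; foldr; foldl; allFin; tabulate)
import Data.List.Properties as LP
open import Data.List.Membership.Propositional.Properties using (∈-allFin)
open import Data.List.Relation.Unary.All as All using (All; []; _∷_)
import Data.List.Relation.Unary.All.Properties as AllP
open import Data.List.Relation.Unary.AllPairs using ([]; _∷_)
open import Data.List.Relation.Unary.Unique.Propositional using (Unique)
import Data.List.Relation.Unary.Unique.Propositional.Properties as UniqueP
open import Data.Nat as ℕ using (ℕ; zero; suc; _<_; _≤_; s≤s; z≤n)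
import Data.Nat.ListAction as NL
import Data.Nat.Properties as NP
open import Data.Product using (_×_; _,_; proj₁; proj₂; Σ-syntax)
open import Data.Sum using (_⊎_; inj₁; inj₂)
open import Data.Unit using (tt)
open import Data.Vec as V using (Vec; lookup)
import Data.Vec.Properties as VP
open import Function using (id; _∘_)
open import Function.Definitions using (Injective)
open import Level using (_⊔_)
open import Relation.Binary.PropositionalEquality as P using (_≡_; _≢_; ≢-sym)
open import Relation.Nullary using (Dec; yes; no; ¬_)
open import Relation.Nullary.Decidable using (⌊_⌋)
open import Relation.Binary.Definitions using (tri<; tri≈; tri>)

module BooleanReflection where
  open P using (refl; sym; trans; cong)

  ⌊⌋-true : ∀ {p} {Q : Set p} (d : Dec Q) → Q → ⌊ d ⌋ ≡ true
  ⌊⌋-true (yes _) q = refl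
  ⌊⌋-true (no ¬q) q = ⊥-elim (¬q q)

  ⌊⌋-false : ∀ {p} {Q : Set p} (d : Dec Q) → ¬ Q → ⌊ d ⌋ ≡ false
  ⌊⌋-false (yes q) ¬q = ⊥-elim (¬q q)
  ⌊⌋-false (no _) ¬q = refl

  ⌊⌋-sound : ∀ {p} {Q : Set p} (d : Dec Q) → ⌊ d ⌋ ≡ true → Q
  ⌊⌋-sound (yes q) _ = q

  ∧-true⁻ : ∀ {a b} → a ∧ b ≡ true → (a ≡ true) × (b ≡ true)
  ∧-true⁻ {true} {true} _ = refl , refl

  ∧-true⁺ : ∀ {a b} → a ≡ true → b ≡ true → a ∧ b ≡ true
  ∧-true⁺ refl refl = refl

  not-true : ∀ {a} → not a ≡ true → a ≡ false
  not-true {false} _ = refl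

  true≢false : true ≢ false
  true≢false ()

  eqF-refl : ∀ {n} (i : Fin n) → eqF i i ≡ true
  eqF-refl i = ⌊⌋-true (i ≟F i) refl

  eqF-≡ : ∀ {n} {i j : Fin n} → i ≡ j → eqF i j ≡ true
  eqF-≡ {i = i} refl = eqF-refl i

  eqF-≢ : ∀ {n} {i j : Fin n} → i ≢ j → eqF i j ≡ false
  eqF-≢ = ⌊⌋-false (_ ≟F _)

  eqF-sound : ∀ {n} {i j : Fin n} → eqF i j ≡ true → i ≡ j
  eqF-sound = ⌊⌋-sound (_ ≟F _)

  eqF-sym : ∀ {n} (i j : Fin n) → eqF i j ≡ eqF j i
  eqF-sym i j with i ≟F j
  ... | yes i≡j = sym (eqF-≡ (sym i≡j))
  ... | no i≢j = sym (eqF-≢ (λ j≡i → i≢j (sym j≡i)))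

  eqF-suc : ∀ {n} (i j : Fin n) → eqF (F.suc i) (F.suc j) ≡ eqF i j
  eqF-suc i j with i ≟F j
  ... | yes _ = refl
  ... | no _ = refl

  ltF-irrefl : ∀ {n} (i : Fin n) → ltF i i ≡ false
  ltF-irrefl i = ⌊⌋-false (toℕ i ℕ.<? toℕ i) (NP.<-irrefl refl)

  ltF-< : ∀ {n} {i k : Fin n} → toℕ i < toℕ k → ltF i k ≡ true
  ltF-< = ⌊⌋-true (_ ℕ.<? _)

  ltF-flip : ∀ {n} {i k : Fin n} → i ≢ k → ltF k i ≡ not (ltF i k)
  ltF-flip {i = i} {k} i≢k with NP.<-cmp (toℕ i) (toℕ k)
  ... | tri< i<k _ _ = trans (⌊⌋-false (_ ℕ.<? _) (NP.<⇒≯ i<k)) (cong not (sym (ltF-< i<k)))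
  ... | tri≈ _ i≡k _ = ⊥-elim (i≢k (toℕ-injective i≡k))
  ... | tri> _ _ k<i = trans (ltF-< k<i) (cong not (sym (⌊⌋-false (_ ℕ.<? _) (NP.<⇒≯ k<i))))

open BooleanReflection

module ListFacts where
  open P using (refl; sym; trans; cong)
  open import Relation.Nullary.Decidable using (T?)

  module _ {a} {A : Set a} where
    filterᵇ-++ : ∀ (p : A → Bool) xs ys → filterᵇ p (xs ++ ys) ≡ filterᵇ p xs ++ filterᵇ p ys
    filterᵇ-++ p = LP.filter-++ (T? ∘ p)

    filterᵇ-all : ∀ (p : A → Bool) {xs} → All (λ x → p x ≡ true) xs → filterᵇ p xs ≡ xs
    filterᵇ-all p = LP.filter-all (T? ∘ p) ∘ All.map (λ px → P.subst T (sym px) tt)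

    filterᵇ-none : ∀ (p : A → Bool) {xs} → All (λ x → p x ≡ false) xs → filterᵇ p xs ≡ []
    filterᵇ-none p = LP.filter-none (T? ∘ p) ∘ All.map (λ px → P.subst T px)

    filterᵇ-All : ∀ {q} {Q : A → Set q} (p : A → Bool) {xs} → All Q xs → All Q (filterᵇ p xs)
    filterᵇ-All p = AllP.filter⁺ (T? ∘ p)

    filterᵇ-congᴬ : ∀ (p q : A → Bool) {xs} → All (λ x → p x ≡ q x) xs → filterᵇ p xs ≡ filterᵇ q xs
    filterᵇ-congᴬ p q [] = refl
    filterᵇ-congᴬ p q {x ∷ xs} (px≡qx ∷ rest) rewrite px≡qx with q x
    ... | true = cong (x ∷_) (filterᵇ-congᴬ p q rest)
    ... | false = filterᵇ-congᴬ p q rest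

    Unique-++ˡ : ∀ xs {ys : List A} → Unique (xs ++ ys) → Unique xs
    Unique-++ˡ [] _ = []
    Unique-++ˡ (x ∷ xs) (x∉ ∷ u) = AllP.++⁻ˡ xs x∉ ∷ Unique-++ˡ xs u

  module _ {n : ℕ} where
    allB-sound : ∀ p → allB p ≡ true → ∀ (i : Fin n) → p i ≡ true
    allB-sound p e i = All.lookup (go (allFin n) e) (∈-allFin i)
      where
      go : ∀ xs → foldr (λ i acc → p i ∧ acc) true xs ≡ true → All (λ i → p i ≡ true) xs
      go [] _ = []
      go (x ∷ xs) e = proj₁ (∧-true⁻ e) ∷ go xs (proj₂ (∧-true⁻ {p x} e))

    allB-complete : ∀ p → (∀ (i : Fin n) → p i ≡ true) → allB p ≡ true
    allB-complete p h = go (allFin n)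
      where
      go : ∀ xs → foldr (λ i acc → p i ∧ acc) true xs ≡ true
      go [] = refl
      go (x ∷ xs) rewrite h x = go xs

    allB-counterexample : ∀ p → allB p ≡ false → Σ[ i ∈ Fin n ] p i ≡ false
    allB-counterexample p = go (allFin n)
      where
      go : ∀ xs → foldr (λ i acc → p i ∧ acc) true xs ≡ false → Σ[ i ∈ Fin n ] p i ≡ false
      go (x ∷ xs) e with p x in px
      ... | true = go xs e
      ... | false = x , px

    allB-false : ∀ p (i : Fin n) → p i ≡ false → allB p ≡ false
    allB-false p i pi≡false with allB p in all≡
    ... | false = refl
    ... | true = ⊥-elim (true≢false (trans (sym (allB-sound p all≡ i)) pi≡false))

  vec-ext : ∀ {n} {A : Set} {v w : Vec A n} → (∀ i → lookup v i ≡ lookup w i) → v ≡ w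
  vec-ext {v = v} {w} h = trans (sym (VP.tabulate∘lookup v)) (trans (VP.tabulate-cong h) (VP.tabulate∘lookup w))

  record SplitAt (n : ℕ) (μ : Fin n) : Set where
    field
      below above : List (Fin n)
      allFin≡ : allFin n ≡ below ++ μ ∷ above
      below< : All (λ i → toℕ i < toℕ μ) below
      above> : All (λ i → toℕ μ < toℕ i) above

  splitAllFin : ∀ {n} (μ : Fin n) → SplitAt n μ
  splitAllFin {suc n} F.zero = record
    { below = [] ; above = tabulate F.suc ; allFin≡ = refl ; below< = [] ; above> = AllP.tabulate⁺ (λ _ → s≤s z≤n) }
  splitAllFin {suc n} (F.suc μ) = record
    { below = F.zero ∷ map F.suc below
    ; above = map F.suc above
    ; allFin≡ = cong (F.zero ∷_) (trans (sym (LP.map-tabulate id F.suc))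
                  (trans (cong (map F.suc) allFin≡) (LP.map-++ F.suc below (μ ∷ above))))
    ; below< = s≤s z≤n ∷ AllP.map⁺ (All.map s≤s below<)
    ; above> = AllP.map⁺ (All.map s≤s above>) }
    where open SplitAt (splitAllFin μ)

open ListFacts

module InversionParity where
  open P using (refl; sym; trans; cong; cong₂)
  open P.≡-Reasoning
  open import Data.Nat.DivMod using ([m+n]%n≡m%n)
  open import Algebra.Properties.CommutativeSemigroup
    (Algebra.Bundles.CommutativeRing.+-commutativeSemigroup BP.xor-∧-commutativeRing)
    using () renaming (interchange to xor-interchange)

  odd : ℕ → Bool
  odd zero = false
  odd (suc k) = not (odd k)

  even-test≡not-odd : ∀ k → (k ℕ.% 2 ℕ.≡ᵇ 0) ≡ not (odd k)
  even-test≡not-odd zero = refl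
  even-test≡not-odd (suc zero) = refl
  even-test≡not-odd (suc (suc k)) = begin
    (suc (suc k) ℕ.% 2 ℕ.≡ᵇ 0) ≡⟨ cong (λ z → z ℕ.% 2 ℕ.≡ᵇ 0) (NP.+-comm 2 k) ⟩
    ((k ℕ.+ 2) ℕ.% 2 ℕ.≡ᵇ 0)   ≡⟨ cong (ℕ._≡ᵇ 0) ([m+n]%n≡m%n k 2) ⟩
    (k ℕ.% 2 ℕ.≡ᵇ 0)           ≡⟨ even-test≡not-odd k ⟩
    not (odd k)                ≡⟨ cong not (sym (BP.not-involutive (odd k))) ⟩
    not (odd (suc (suc k)))    ∎

  odd-+ : ∀ a b → odd (a ℕ.+ b) ≡ odd a xor odd b
  odd-+ zero b = refl
  odd-+ (suc a) b = trans (cong not (odd-+ a b)) (BP.not-distribˡ-xor (odd a) (odd b))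

  module _ {a} {A : Set a} where
    xorSum : List A → (A → Bool) → Bool
    xorSum xs f = foldr (λ x acc → f x xor acc) false xs

    xorSum-cong : ∀ xs {f g : A → Bool} → (∀ x → f x ≡ g x) → xorSum xs f ≡ xorSum xs g
    xorSum-cong [] eq = refl
    xorSum-cong (x ∷ xs) eq = cong₂ _xor_ (eq x) (xorSum-cong xs eq)

    xorSum-xor : ∀ xs (f g : A → Bool) → xorSum xs (λ x → f x xor g x) ≡ xorSum xs f xor xorSum xs g
    xorSum-xor [] f g = refl
    xorSum-xor (x ∷ xs) f g =
      trans (cong ((f x xor g x) xor_) (xorSum-xor xs f g)) (xor-interchange (f x) (g x) _ _)

    xorSum-false : ∀ xs → xorSum xs (λ _ → false) ≡ false
    xorSum-false [] = refl
    xorSum-false (x ∷ xs) = xorSum-false xs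

    odd-count : ∀ (p : A → Bool) xs → odd (foldr (λ i acc → if p i then suc acc else acc) 0 xs) ≡ xorSum xs p
    odd-count p [] = refl
    odd-count p (x ∷ xs) with p x
    ... | true = cong not (odd-count p xs)
    ... | false = odd-count p xs

    odd-sum : ∀ (g : A → ℕ) xs → odd (NL.sum (map g xs)) ≡ xorSum xs (odd ∘ g)
    odd-sum g [] = refl
    odd-sum g (x ∷ xs) = trans (odd-+ (g x) _) (cong (odd (g x) xor_) (odd-sum g xs))

  xorSum-map : ∀ {a b} {A : Set a} {B : Set b} (g : A → B) xs (f : B → Bool) → xorSum (map g xs) f ≡ xorSum xs (f ∘ g)
  xorSum-map g [] f = refl
  xorSum-map g (x ∷ xs) f = cong (f (g x) xor_) (xorSum-map g xs f)

  xorSum-allFin-suc : ∀ {n} (f : Fin (suc n) → Bool) → xorSum (allFin (suc n)) f ≡ f F.zero xor xorSum (allFin n) (f ∘ F.suc)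
  xorSum-allFin-suc {n} f =
    cong (f F.zero xor_) (trans (cong (λ l → xorSum l f) (sym (LP.map-tabulate id F.suc))) (xorSum-map F.suc (allFin n) f))

  xorSum-δ : ∀ {n} (j : Fin n) (v : Fin n → Bool) → xorSum (allFin n) (λ k → eqF k j ∧ v k) ≡ v j
  xorSum-δ {suc n} F.zero v = begin
    xorSum (allFin (suc n)) (λ k → eqF k F.zero ∧ v k)      ≡⟨ xorSum-allFin-suc (λ k → eqF k F.zero ∧ v k) ⟩
    v F.zero xor xorSum (allFin n) (λ _ → false)            ≡⟨ cong (v F.zero xor_) (xorSum-false (allFin n)) ⟩
    v F.zero xor false                                       ≡⟨ BP.xor-identityʳ _ ⟩
    v F.zero                                                 ∎
  xorSum-δ {suc n} (F.suc j) v = begin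
    xorSum (allFin (suc n)) (λ k → eqF k (F.suc j) ∧ v k)   ≡⟨ xorSum-allFin-suc (λ k → eqF k (F.suc j) ∧ v k) ⟩
    xorSum (allFin n) (λ k → eqF (F.suc k) (F.suc j) ∧ v (F.suc k))
      ≡⟨ xorSum-cong (allFin n) (λ k → cong (_∧ v (F.suc k)) (eqF-suc k j)) ⟩
    xorSum (allFin n) (λ k → eqF k j ∧ v (F.suc k))         ≡⟨ xorSum-δ j (v ∘ F.suc) ⟩
    v (F.suc j)                                              ∎

  isInversion : ∀ {n} → (Fin n → Fin n) → Fin n → Fin n → Bool
  isInversion s i k = ltF i k ∧ ltF (s k) (s i)

  inversionParity : ∀ {n} → (Fin n → Fin n) → Bool
  inversionParity {n} s = xorSum (allFin n) (λ i → xorSum (allFin n) (isInversion s i))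

  inversionParity-cong : ∀ {n} {s s′ : Fin n → Fin n} → (∀ i → s i ≡ s′ i) → inversionParity s ≡ inversionParity s′
  inversionParity-cong {n} eq = xorSum-cong (allFin n) λ i → xorSum-cong (allFin n) λ k → cong₂ (λ a b → ltF i k ∧ ltF a b) (eq k) (eq i)

  odd-inversions : ∀ {n} (σ : Vec (Fin n) n) → odd (inversions σ) ≡ inversionParity (lookup σ)
  odd-inversions {n} σ = trans (odd-sum _ (allFin n)) (xorSum-cong (allFin n) (λ i → odd-count _ (allFin n)))

  transposition : ∀ {n} → Fin n → Fin n → Fin n → Fin n
  transposition j μ i = if eqF i j then μ else (if eqF i μ then j else i)

  module Transposition {n} (j μ : Fin n) (j<μ : toℕ j < toℕ μ) where
    t : Fin n → Fin n
    t = transposition j μ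

    j≢μ : j ≢ μ
    j≢μ eq = NP.<-irrefl (cong toℕ eq) j<μ

    μ≢j : μ ≢ j
    μ≢j eq = j≢μ (sym eq)

    t-j : t j ≡ μ
    t-j rewrite eqF-refl j = refl

    t-μ : t μ ≡ j
    t-μ rewrite eqF-≢ μ≢j | eqF-refl μ = refl

    t-other : ∀ {k} → k ≢ j → k ≢ μ → t k ≡ k
    t-other k≢j k≢μ rewrite eqF-≢ k≢j | eqF-≢ k≢μ = refl

    t-involutive : ∀ k → t (t k) ≡ k
    t-involutive k = by-cases (k ≟F j) (k ≟F μ)
      where
      by-cases : Dec (k ≡ j) → Dec (k ≡ μ) → t (t k) ≡ k
      by-cases (yes refl) _ = trans (cong t t-j) t-μ
      by-cases (no _) (yes refl) = trans (cong t t-μ) t-j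
      by-cases (no k≢j) (no k≢μ) = trans (cong t (t-other k≢j k≢μ)) (t-other k≢j k≢μ)

    -- Composing with t toggles the inversion status of the pair {j , μ}; for k
    -- outside {j , μ} it toggles {j , k} and {μ , k} simultaneously or not at
    -- all, so those changes cancel in pairs (columns-cancel).
    module _ (s : Fin n → Fin n) (s-inj : ∀ {x y} → s x ≡ s y → x ≡ y) where
      private
        all = allFin n

        s≢ : ∀ {x y} → x ≢ y → s x ≢ s y
        s≢ x≢y sx≡sy = x≢y (s-inj sx≡sy)

        Δ : Fin n → Fin n → Bool
        Δ i k = isInversion s i k xor isInversion (s ∘ t) i k

        outside : Fin n → Bool
        outside k = not (eqF k j) ∧ not (eqF k μ)

        belowSwitch aboveSwitch : Fin n → Bool
        belowSwitch k = ltF (s k) (s j) xor ltF (s k) (s μ)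
        aboveSwitch k = ltF (s j) (s k) xor ltF (s μ) (s k)

        colj colμ : Fin n → Bool
        colj k = outside k ∧ (ltF j k ∧ belowSwitch k)
        colμ k = outside k ∧ (ltF μ k ∧ belowSwitch k)

        rowOther : Fin n → Bool
        rowOther i = (ltF i j ∧ aboveSwitch i) xor (ltF i μ ∧ aboveSwitch i)

        rowSum : Fin n → Bool
        rowSum i = (eqF i j ∧ (true xor xorSum all colj)) xor ((eqF i μ ∧ xorSum all colμ) xor (outside i ∧ rowOther i))

        j<μ-test : ltF j μ ≡ true
        j<μ-test = ltF-< j<μ

        μ<j-test : ltF μ j ≡ false
        μ<j-test = trans (ltF-flip j≢μ) (cong not j<μ-test)

        Δ-row-j : ∀ k → Δ j k ≡ (eqF k μ ∧ true) xor colj k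
        Δ-row-j k with k ≟F j
        ... | yes refl rewrite eqF-≢ j≢μ | eqF-refl j | ltF-irrefl j = refl
        ... | no k≢j with k ≟F μ
        ...   | yes refl rewrite t-j | j<μ-test | ltF-flip {i = s j} {s μ} (s≢ j≢μ) =
                BP.xor-inverseˡ (ltF (s j) (s μ))
        ...   | no k≢μ rewrite t-j = sym (BP.∧-distribˡ-xor (ltF j k) _ _)

        Δ-row-μ : ∀ k → Δ μ k ≡ colμ k
        Δ-row-μ k with k ≟F j
        ... | yes refl rewrite μ<j-test = refl
        ... | no k≢j with k ≟F μ
        ...   | yes refl rewrite eqF-refl μ | ltF-irrefl μ = refl
        ...   | no k≢μ rewrite t-μ =
                trans (sym (BP.∧-distribˡ-xor (ltF μ k) _ _)) (cong (ltF μ k ∧_) (BP.xor-comm (ltF (s k) (s μ)) (ltF (s k) (s j))))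

        Δ-row-other : ∀ i → i ≢ j → i ≢ μ → ∀ k → Δ i k ≡ (eqF k j ∧ (ltF i j ∧ aboveSwitch i)) xor (eqF k μ ∧ (ltF i μ ∧ aboveSwitch i))
        Δ-row-other i i≢j i≢μ k rewrite t-other i≢j i≢μ with k ≟F j
        ... | yes refl rewrite eqF-≢ j≢μ =
              trans (sym (BP.∧-distribˡ-xor (ltF i j) _ _)) (sym (BP.xor-identityʳ _))
        ... | no k≢j with k ≟F μ
        ...   | yes refl =
                trans (sym (BP.∧-distribˡ-xor (ltF i μ) _ _)) (cong (ltF i μ ∧_) (BP.xor-comm (ltF (s μ) (s i)) (ltF (s j) (s i))))
        ...   | no k≢μ = BP.xor-same (isInversion s i k)

        rowSum-j : rowSum j ≡ true xor xorSum all colj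
        rowSum-j rewrite eqF-≢ j≢μ | eqF-refl j = BP.xor-identityʳ _

        rowSum-μ : rowSum μ ≡ xorSum all colμ
        rowSum-μ rewrite eqF-≢ μ≢j | eqF-refl μ = BP.xor-identityʳ _

        rowSum-other : ∀ {i} → i ≢ j → i ≢ μ → rowSum i ≡ rowOther i
        rowSum-other i≢j i≢μ rewrite eqF-≢ i≢j | eqF-≢ i≢μ = refl

        Δ-row : ∀ i → xorSum all (Δ i) ≡ rowSum i
        Δ-row i = by-cases (i ≟F j) (i ≟F μ)
          where
          by-cases : Dec (i ≡ j) → Dec (i ≡ μ) → xorSum all (Δ i) ≡ rowSum i
          by-cases (yes refl) _ = begin
            xorSum all (Δ j)                                           ≡⟨ xorSum-cong all Δ-row-j ⟩
            xorSum all (λ k → (eqF k μ ∧ true) xor colj k)             ≡⟨ xorSum-xor all (λ k → eqF k μ ∧ true) colj ⟩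
            xorSum all (λ k → eqF k μ ∧ true) xor xorSum all colj
              ≡⟨ cong (_xor xorSum all colj) (xorSum-δ μ (λ _ → true)) ⟩
            true xor xorSum all colj                                   ≡⟨ sym rowSum-j ⟩
            rowSum j                                                   ∎
          by-cases (no _) (yes refl) = trans (xorSum-cong all Δ-row-μ) (sym rowSum-μ)
          by-cases (no i≢j) (no i≢μ) = begin
            xorSum all (Δ i)                          ≡⟨ xorSum-cong all (Δ-row-other i i≢j i≢μ) ⟩
            xorSum all (λ k → (eqF k j ∧ Lj) xor (eqF k μ ∧ Lμ))
              ≡⟨ xorSum-xor all (λ k → eqF k j ∧ Lj) (λ k → eqF k μ ∧ Lμ) ⟩
            xorSum all (λ k → eqF k j ∧ Lj) xor xorSum all (λ k → eqF k μ ∧ Lμ)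
              ≡⟨ cong₂ _xor_ (xorSum-δ j (λ _ → ltF i j ∧ aboveSwitch i)) (xorSum-δ μ (λ _ → ltF i μ ∧ aboveSwitch i)) ⟩
            rowOther i                                ≡⟨ sym (rowSum-other i≢j i≢μ) ⟩
            rowSum i                                  ∎
            where
            Lj = ltF i j ∧ aboveSwitch i
            Lμ = ltF i μ ∧ aboveSwitch i

        columns-cancel : ∀ k → colj k xor (colμ k xor (outside k ∧ rowOther k)) ≡ false
        columns-cancel k with k ≟F j
        ... | yes refl = refl
        ... | no k≢j with k ≟F μ
        ...   | yes refl = refl
        ...   | no k≢μ
                rewrite ltF-flip {i = j} {k} (λ e → k≢j (sym e)) | ltF-flip {i = μ} {k} (λ e → k≢μ (sym e))
                | ltF-flip {i = s k} {s j} (s≢ k≢j) | ltF-flip {i = s k} {s μ} (s≢ k≢μ)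
                | BP.xor-annihilates-not (ltF (s k) (s j)) (ltF (s k) (s μ)) =
                cancel (ltF j k) (ltF μ k) (ltF (s k) (s j) xor ltF (s k) (s μ))
          where
          cancel : ∀ a b d → (a ∧ d) xor ((b ∧ d) xor ((not a ∧ d) xor (not b ∧ d))) ≡ false
          cancel true true true = refl
          cancel true true false = refl
          cancel true false true = refl
          cancel true false false = refl
          cancel false true true = refl
          cancel false true false = refl
          cancel false false true = refl
          cancel false false false = refl

        parities-differ : inversionParity s xor inversionParity (s ∘ t) ≡ true
        parities-differ = begin
          inversionParity s xor inversionParity (s ∘ t)
            ≡⟨ sym (xorSum-xor all (λ i → xorSum all (isInversion s i)) (λ i → xorSum all (isInversion (s ∘ t) i))) ⟩
          xorSum all (λ i → xorSum all (isInversion s i) xor xorSum all (isInversion (s ∘ t) i))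
            ≡⟨ xorSum-cong all (λ i → trans (sym (xorSum-xor all (isInversion s i) (isInversion (s ∘ t) i))) (Δ-row i)) ⟩
          xorSum all rowSum
            ≡⟨ xorSum-xor all (λ i → eqF i j ∧ (true xor Xj)) _ ⟩
          xorSum all (λ i → eqF i j ∧ (true xor Xj)) xor xorSum all (λ i → (eqF i μ ∧ Xμ) xor (outside i ∧ rowOther i))
            ≡⟨ cong₂ _xor_ (xorSum-δ j _) (xorSum-xor all (λ i → eqF i μ ∧ Xμ) (λ i → outside i ∧ rowOther i)) ⟩
          (true xor Xj) xor (xorSum all (λ i → eqF i μ ∧ Xμ) xor Xrest)
            ≡⟨ cong (λ z → (true xor Xj) xor (z xor Xrest)) (xorSum-δ μ _) ⟩
          (true xor Xj) xor (Xμ xor Xrest)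
            ≡⟨ BP.xor-assoc true Xj (Xμ xor Xrest) ⟩
          true xor (Xj xor (Xμ xor Xrest))
            ≡⟨ cong (λ z → true xor (Xj xor z)) (sym (xorSum-xor all colμ (λ k → outside k ∧ rowOther k))) ⟩
          true xor (Xj xor xorSum all (λ k → colμ k xor (outside k ∧ rowOther k)))
            ≡⟨ cong (true xor_) (sym (xorSum-xor all colj (λ k → colμ k xor (outside k ∧ rowOther k)))) ⟩
          true xor xorSum all (λ k → colj k xor (colμ k xor (outside k ∧ rowOther k)))
            ≡⟨ cong (true xor_) (trans (xorSum-cong all columns-cancel) (xorSum-false all)) ⟩
          true ∎
          where
          Xj = xorSum all colj
          Xμ = xorSum all colμ
          Xrest = xorSum all (λ i → outside i ∧ rowOther i)

      inversionParity-∘-transposition : inversionParity (s ∘ t) ≡ not (inversionParity s)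
      inversionParity-∘-transposition = xor≡true (inversionParity s) (inversionParity (s ∘ t)) parities-differ
        where
        xor≡true : ∀ a b → a xor b ≡ true → b ≡ not a
        xor≡true true false _ = refl
        xor≡true false true _ = refl

    swapPositions : Vec (Fin n) n → Vec (Fin n) n
    swapPositions σ = V.tabulate (lookup σ ∘ t)

    lookup-swapPositions : ∀ σ i → lookup (swapPositions σ) i ≡ lookup σ (t i)
    lookup-swapPositions σ i = VP.lookup∘tabulate (lookup σ ∘ t) i

    swapPositions-j : ∀ σ → lookup (swapPositions σ) j ≡ lookup σ μ
    swapPositions-j σ = trans (lookup-swapPositions σ j) (cong (lookup σ) t-j)

    swapPositions-μ : ∀ σ → lookup (swapPositions σ) μ ≡ lookup σ j
    swapPositions-μ σ = trans (lookup-swapPositions σ μ) (cong (lookup σ) t-μ)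

    swapPositions-other : ∀ σ {i} → i ≢ j → i ≢ μ → lookup (swapPositions σ) i ≡ lookup σ i
    swapPositions-other σ i≢j i≢μ = trans (lookup-swapPositions σ _) (cong (lookup σ) (t-other i≢j i≢μ))

    swapPositions-involutive : ∀ σ → swapPositions (swapPositions σ) ≡ σ
    swapPositions-involutive σ = vec-ext λ i →
      trans (lookup-swapPositions (swapPositions σ) i) (trans (lookup-swapPositions σ (t i)) (cong (lookup σ) (t-involutive i)))

    swapPositions-injective : ∀ σ → Injective _≡_ _≡_ (lookup σ) → Injective _≡_ _≡_ (lookup (swapPositions σ))
    swapPositions-injective σ σ-inj {x} {y} eq = begin
      x         ≡⟨ sym (t-involutive x) ⟩
      t (t x)   ≡⟨ cong t (σ-inj (trans (sym (lookup-swapPositions σ x)) (trans eq (lookup-swapPositions σ y)))) ⟩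
      t (t y)   ≡⟨ t-involutive y ⟩
      y         ∎

    odd-inversions-swapPositions : ∀ σ → Injective _≡_ _≡_ (lookup σ) →
                                   odd (inversions (swapPositions σ)) ≡ not (odd (inversions σ))
    odd-inversions-swapPositions σ σ-inj = begin
      odd (inversions (swapPositions σ))         ≡⟨ odd-inversions (swapPositions σ) ⟩
      inversionParity (lookup (swapPositions σ)) ≡⟨ inversionParity-cong (lookup-swapPositions σ) ⟩
      inversionParity (lookup σ ∘ t)             ≡⟨ inversionParity-∘-transposition (lookup σ) σ-inj ⟩
      not (inversionParity (lookup σ))           ≡⟨ cong not (sym (odd-inversions σ)) ⟩
      not (odd (inversions σ))                   ∎

open InversionParity

module CapelliConfigurations where
  open P using (refl; sym; trans; cong; cong₂; subst)

  FinMap : ℕ → Set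
  FinMap n = Vec (Fin n) n

  Config : ℕ → Set
  Config n = FinMap n × FinMap n

  zeroOf : ∀ {n} → Fin n → Fin n
  zeroOf {suc n} _ = F.zero

  toℕ-zeroOf : ∀ {n} (i : Fin n) → toℕ (zeroOf i) ≡ 0
  toℕ-zeroOf {suc n} _ = refl

  module _ {n : ℕ} where
    isPerm-injective : ∀ (σ : FinMap n) → isPerm σ ≡ true → Injective _≡_ _≡_ (lookup σ)
    isPerm-injective σ e {x} {y} σx≡σy = eqF-sound (distinct (allB-sound _ (allB-sound _ e x) y))
      where
      distinct : not (eqF (lookup σ x) (lookup σ y)) ∨ eqF x y ≡ true → eqF x y ≡ true
      distinct h rewrite eqF-≡ σx≡σy = h

    injective-isPerm : ∀ (σ : FinMap n) → Injective _≡_ _≡_ (lookup σ) → isPerm σ ≡ true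
    injective-isPerm σ σ-inj = allB-complete _ λ x → allB-complete _ λ y → distinct x y
      where
      distinct : ∀ x y → not (eqF (lookup σ x) (lookup σ y)) ∨ eqF x y ≡ true
      distinct x y with lookup σ x ≟F lookup σ y
      ... | no _ = refl
      ... | yes σx≡σy rewrite eqF-≡ (σ-inj σx≡σy) = refl

    capelliAt : Fin n → Fin n → Fin n → Bool
    capelliAt s f i = if eqF s i then ⌊ toℕ f ℕ.≤? toℕ i ⌋ else (toℕ f ℕ.≡ᵇ 0)

    inCmAt : ℕ → Fin n → Fin n → Fin n → Bool
    inCmAt m s f k = not (eqF s k ∧ ltF f k) ∨ ⌊ m ℕ.≤? suc (toℕ k) ⌋

    keepAt : Fin n → Fin n → Fin n → Bool
    keepAt s f i = not (eqF s i) ∨ eqF f i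

    AdmissibleAt : ℕ → FinMap n → FinMap n → Fin n → Set
    AdmissibleAt m σ φ i = capelliAt (lookup σ i) (lookup φ i) i ≡ true × inCmAt m (lookup σ i) (lookup φ i) i ≡ true

    memberC : ℕ → FinMap n → FinMap n → Bool
    memberC m σ φ = isCapelli σ φ ∧ inCm m σ φ

    record InC (m : ℕ) (σ φ : FinMap n) : Set where
      field
        injective : Injective _≡_ _≡_ (lookup σ)
        capelliAt-holds : ∀ i → capelliAt (lookup σ i) (lookup φ i) i ≡ true
        inCmAt-holds : ∀ i → inCmAt m (lookup σ i) (lookup φ i) i ≡ true

    memberC-sound : ∀ m σ φ → memberC m σ φ ≡ true → InC m σ φ
    memberC-sound m σ φ e = record
      { injective = isPerm-injective σ (proj₁ (∧-true⁻ (proj₁ (∧-true⁻ e))))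
      ; capelliAt-holds = allB-sound _ (proj₂ (∧-true⁻ {isPerm σ} (proj₁ (∧-true⁻ e))))
      ; inCmAt-holds = allB-sound _ (proj₂ (∧-true⁻ {isCapelli σ φ} e)) }

    memberC-complete : ∀ m σ φ → InC m σ φ → memberC m σ φ ≡ true
    memberC-complete m σ φ c =
      ∧-true⁺ (∧-true⁺ (injective-isPerm σ (InC.injective c)) (allB-complete _ (InC.capelliAt-holds c))) (allB-complete _ (InC.inCmAt-holds c))

    inCmAt-antitone : ∀ {m m′} → m ≤ m′ → ∀ s f i → inCmAt m′ s f i ≡ true → inCmAt m s f i ≡ true
    inCmAt-antitone m≤m′ s f i e with not (eqF s i ∧ ltF f i)
    ... | true = refl
    ... | false = ⌊⌋-true (_ ℕ.≤? _) (NP.≤-trans m≤m′ (⌊⌋-sound (_ ℕ.≤? suc (toℕ i)) e))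

    InC-antitone : ∀ {m m′ σ φ} → m ≤ m′ → InC m′ σ φ → InC m σ φ
    InC-antitone {σ = σ} {φ} m≤m′ c = record
      { injective = InC.injective c ; capelliAt-holds = InC.capelliAt-holds c
      ; inCmAt-holds = λ i → inCmAt-antitone m≤m′ (lookup σ i) (lookup φ i) i (InC.inCmAt-holds c i) }

    -- Below the threshold m there is no freedom left in φ: it is i at a fixed
    -- point i and the dummy value 0 elsewhere.
    forcedφ : Fin n → Fin n → Fin n
    forcedφ s i = if eqF s i then i else zeroOf i

    forcedφ-capelliAt : ∀ s i → capelliAt s (forcedφ s i) i ≡ true
    forcedφ-capelliAt s i with eqF s i
    ... | true = ⌊⌋-true (toℕ i ℕ.≤? toℕ i) NP.≤-refl
    ... | false rewrite toℕ-zeroOf i = refl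

    forcedφ-inCmAt : ∀ m s i → inCmAt m s (forcedφ s i) i ≡ true
    forcedφ-inCmAt m s i with eqF s i
    ... | true rewrite ltF-irrefl i = refl
    ... | false = refl

    forcedφ-keepAt : ∀ s i → keepAt s (forcedφ s i) i ≡ true
    forcedφ-keepAt s i with eqF s i
    ... | true rewrite eqF-refl i = refl
    ... | false = refl

    below-threshold-forced : ∀ m s f i → capelliAt s f i ≡ true → inCmAt m s f i ≡ true →
                             ¬ (m ≤ suc (toℕ i)) → f ≡ forcedφ s i
    below-threshold-forced m s f i cap inc below with eqF s i
    ... | true rewrite ⌊⌋-false (m ℕ.≤? suc (toℕ i)) below with toℕ f ℕ.≤? toℕ i | toℕ f ℕ.<? toℕ i
    ...   | yes f≤i | no f≮i = toℕ-injective (NP.≤-antisym f≤i (NP.≮⇒≥ f≮i))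
    below-threshold-forced m s f i cap () below | true | yes _ | yes _
    below-threshold-forced m s f i () inc below | true | no _ | _
    below-threshold-forced m s f i cap inc below | false =
      toℕ-injective (trans (NP.≡ᵇ⇒≡ (toℕ f) 0 (subst T (sym cap) tt)) (sym (toℕ-zeroOf i)))

    InC-forced : ∀ {m σ φ} → InC m σ φ → ∀ i → ¬ (m ≤ suc (toℕ i)) → lookup φ i ≡ forcedφ (lookup σ i) i
    InC-forced {m} {σ} {φ} c i = below-threshold-forced m (lookup σ i) (lookup φ i) i (InC.capelliAt-holds c i) (InC.inCmAt-holds c i)

    InC-keep : ∀ {m σ φ} → InC m σ φ → ∀ i → ¬ (m ≤ suc (toℕ i)) → keep σ φ i ≡ true
    InC-keep {σ = σ} c i below rewrite InC-forced c i below = forcedφ-keepAt (lookup σ i) i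

open CapelliConfigurations

-- μF is the paper's m as a 0-based index, so m₀ is the paper's m and m₁ is m + 1.
module Threshold {n : ℕ} (μF : Fin n) where
  open P using (refl; sym; trans; cong; cong₂; subst)

  μ m₀ m₁ : ℕ
  μ = toℕ μF
  m₀ = suc μ
  m₁ = suc m₀

  open SplitAt (splitAllFin μF) public

  below-Unique : Unique below
  below-Unique = Unique-++ˡ below (subst Unique allFin≡ (UniqueP.allFin⁺ n))

  keptAbove : FinMap n → FinMap n → List (Fin n)
  keptAbove σ φ = filterᵇ (keep σ φ) above

  InC-keep-below : ∀ {σ φ : FinMap n} → InC m₀ σ φ → All (λ i → keep σ φ i ≡ true) below
  InC-keep-below c = All.map (λ {i} i<μ → InC-keep c i (λ m₀≤ → NP.<⇒≱ i<μ (NP.≤-pred m₀≤))) below<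

  InC-keep-μ : ∀ {σ φ : FinMap n} → InC m₁ σ φ → keep σ φ μF ≡ true
  InC-keep-μ c = InC-keep c μF (λ m₁≤ → NP.<-irrefl refl (NP.≤-pred m₁≤))

  C[m₀]-C[m₁] : ∀ {σ φ : FinMap n} → InC m₀ σ φ → inCm m₁ σ φ ≡ false → (lookup σ μF ≡ μF) × (toℕ (lookup φ μF) < μ)
  C[m₀]-C[m₁] {σ} {φ} c e with allB-counterexample _ e
  ... | (k , fails) = witness (InC.inCmAt-holds c k) fails
    where
    witness : inCmAt m₀ (lookup σ k) (lookup φ k) k ≡ true → inCmAt m₁ (lookup σ k) (lookup φ k) k ≡ false →
              (lookup σ μF ≡ μF) × (toℕ (lookup φ μF) < μ)
    witness h₀ h₁ with eqF (lookup σ k) k ∧ ltF (lookup φ k) k in fixed<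
    witness h₀ () | false
    ... | true with m₀ ℕ.≤? suc (toℕ k) | m₁ ℕ.≤? suc (toℕ k)
    ...   | yes m₀≤ | no m₁≰ with toℕ-injective (NP.≤-antisym (NP.≤-pred m₀≤) (NP.≮⇒≥ (λ k<μ → m₁≰ (s≤s k<μ))))
    ...     | refl = eqF-sound (proj₁ (∧-true⁻ fixed<)) , ⌊⌋-sound (_ ℕ.<? _) (proj₂ (∧-true⁻ {eqF (lookup σ μF) μF} fixed<))
    witness () h₁ | true | no _ | _
    witness h₀ () | true | yes _ | yes _

  memberC-leaving : ∀ {σ φ : FinMap n} → memberC m₀ σ φ ≡ true → memberC m₁ σ φ ≡ false → inCm m₁ σ φ ≡ false
  memberC-leaving {σ} {φ} in₀ out₁ with isCapelli σ φ | inCm m₁ σ φ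
  ... | true | false = refl
  memberC-leaving in₀ () | true | true
  memberC-leaving () out₁ | false | _

  drop-μ : ∀ {σ φ : FinMap n} → lookup σ μF ≡ μF → toℕ (lookup φ μF) < μ → keep σ φ μF ≡ false
  drop-μ {σ} {φ} σμ≡μ φμ<μ rewrite σμ≡μ | eqF-refl μF = eqF-≢ (λ φμ≡μ → NP.<-irrefl (cong toℕ φμ≡μ) φμ<μ)

  module Involutions (j : Fin n) (j<μ : toℕ j < μ) where
    open Transposition j μF j<μ public using (j≢μ; μ≢j; swapPositions; swapPositions-j; swapPositions-μ; swapPositions-other)
    open Transposition j μF j<μ using (swapPositions-involutive; swapPositions-injective)

    resetφ markφ : FinMap n → FinMap n → FinMap n
    resetφ σ φ = V.tabulate λ i → if eqF i j ∨ eqF i μF then forcedφ (lookup (swapPositions σ) i) i else lookup φ i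
    markφ σ φ = V.tabulate λ i → if eqF i μF then j else (if eqF i j then forcedφ (lookup (swapPositions σ) i) i else lookup φ i)

    swapReset swapMark : Config n → Config n
    swapReset (σ , φ) = swapPositions σ , resetφ σ φ
    swapMark (σ , φ) = swapPositions σ , markφ σ φ

    resetφ-j : ∀ σ φ → lookup (resetφ σ φ) j ≡ forcedφ (lookup (swapPositions σ) j) j
    resetφ-j σ φ rewrite VP.lookup∘tabulate (λ i → if eqF i j ∨ eqF i μF then forcedφ (lookup (swapPositions σ) i) i else lookup φ i) j
                       | eqF-refl j = refl

    resetφ-μ : ∀ σ φ → lookup (resetφ σ φ) μF ≡ forcedφ (lookup (swapPositions σ) μF) μF
    resetφ-μ σ φ rewrite VP.lookup∘tabulate (λ i → if eqF i j ∨ eqF i μF then forcedφ (lookup (swapPositions σ) i) i else lookup φ i) μF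
                       | eqF-≢ μ≢j | eqF-refl μF = refl

    resetφ-other : ∀ σ φ {i} → i ≢ j → i ≢ μF → lookup (resetφ σ φ) i ≡ lookup φ i
    resetφ-other σ φ {i} i≢j i≢μ
      rewrite VP.lookup∘tabulate (λ i → if eqF i j ∨ eqF i μF then forcedφ (lookup (swapPositions σ) i) i else lookup φ i) i
            | eqF-≢ i≢j | eqF-≢ i≢μ = refl

    markφ-μ : ∀ σ φ → lookup (markφ σ φ) μF ≡ j
    markφ-μ σ φ rewrite VP.lookup∘tabulate (λ i → if eqF i μF then j else (if eqF i j then forcedφ (lookup (swapPositions σ) i) i else lookup φ i)) μF
                      | eqF-refl μF = refl

    markφ-j : ∀ σ φ → lookup (markφ σ φ) j ≡ forcedφ (lookup (swapPositions σ) j) j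
    markφ-j σ φ rewrite VP.lookup∘tabulate (λ i → if eqF i μF then j else (if eqF i j then forcedφ (lookup (swapPositions σ) i) i else lookup φ i)) j
                      | eqF-≢ j≢μ | eqF-refl j = refl

    markφ-other : ∀ σ φ {i} → i ≢ j → i ≢ μF → lookup (markφ σ φ) i ≡ lookup φ i
    markφ-other σ φ {i} i≢j i≢μ
      rewrite VP.lookup∘tabulate (λ i → if eqF i μF then j else (if eqF i j then forcedφ (lookup (swapPositions σ) i) i else lookup φ i)) i
            | eqF-≢ i≢j | eqF-≢ i≢μ = refl

    above-outside : All (λ i → i ≢ j × i ≢ μF) above
    above-outside = All.map (λ μ<i → (λ i≡j → NP.<-asym j<μ (subst (λ w → μ < toℕ w) i≡j μ<i))
                                   , (λ i≡μ → NP.<-irrefl (cong toℕ (sym i≡μ)) μ<i)) above>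

    module _ {σ φ σ′ φ′ : FinMap n}
             (σ-agree : ∀ {i} → i ≢ j → i ≢ μF → lookup σ′ i ≡ lookup σ i)
             (φ-agree : ∀ {i} → i ≢ j → i ≢ μF → lookup φ′ i ≡ lookup φ i) where
      keptAbove-agree : keptAbove σ′ φ′ ≡ keptAbove σ φ
      keptAbove-agree = filterᵇ-congᴬ (keep σ′ φ′) (keep σ φ)
        (All.map (λ {i} (i≢j , i≢μ) → cong₂ (λ s f → keepAt s f i) (σ-agree i≢j i≢μ) (φ-agree i≢j i≢μ)) above-outside)

      σ-agree-keptAbove : All (λ i → lookup σ′ i ≡ lookup σ i) (keptAbove σ φ)
      σ-agree-keptAbove = All.map (λ (i≢j , i≢μ) → σ-agree i≢j i≢μ) (filterᵇ-All (keep σ φ) above-outside)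

    j-below-m₀ : ¬ (m₀ ≤ suc (toℕ j))
    j-below-m₀ m₀≤ = NP.<⇒≱ j<μ (NP.≤-pred m₀≤)

    j-below-m₁ : ¬ (m₁ ≤ suc (toℕ j))
    j-below-m₁ m₁≤ = j-below-m₀ (NP.≤-trans (NP.n≤1+n m₀) m₁≤)

    μ-below-m₁ : ¬ (m₁ ≤ suc μ)
    μ-below-m₁ m₁≤ = NP.<-irrefl refl (NP.≤-pred m₁≤)

    InC-patch : ∀ {m m′ σ φ σ′ φ′} → InC m σ φ → Injective _≡_ _≡_ (lookup σ′) →
      (∀ {i} → i ≢ j → i ≢ μF → lookup σ′ i ≡ lookup σ i) →
      (∀ {i} → i ≢ j → i ≢ μF → lookup φ′ i ≡ lookup φ i) →
      (∀ s f {i} → i ≢ j → i ≢ μF → inCmAt m s f i ≡ true → inCmAt m′ s f i ≡ true) →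
      (∀ i → i ≡ j ⊎ i ≡ μF → AdmissibleAt m′ σ′ φ′ i) →
      InC m′ σ′ φ′
    InC-patch {σ′ = σ′} {φ′} c σ′-inj σ-agree φ-agree inCm-transfer patched =
      record { injective = σ′-inj ; capelliAt-holds = proj₁ ∘ holds ; inCmAt-holds = proj₂ ∘ holds }
      where
      holds : ∀ i → AdmissibleAt _ σ′ φ′ i
      holds i with i ≟F j | i ≟F μF
      ... | yes i≡j | _ = patched i (inj₁ i≡j)
      ... | no _ | yes i≡μ = patched i (inj₂ i≡μ)
      ... | no i≢j | no i≢μ rewrite σ-agree i≢j i≢μ | φ-agree i≢j i≢μ =
            InC.capelliAt-holds c i , inCm-transfer _ _ i≢j i≢μ (InC.inCmAt-holds c i)

    inCmAt-m₀⇒m₁ : ∀ s f {i} → i ≢ j → i ≢ μF → inCmAt m₀ s f i ≡ true → inCmAt m₁ s f i ≡ true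
    inCmAt-m₀⇒m₁ s f {i} _ i≢μ e with not (eqF s i ∧ ltF f i)
    ... | true = refl
    ... | false = ⌊⌋-true (m₁ ℕ.≤? _) (s≤s (NP.≤∧≢⇒< (NP.≤-pred (⌊⌋-sound (m₀ ℕ.≤? suc (toℕ i)) e))
                                                      (λ μ≡i → i≢μ (toℕ-injective (sym μ≡i)))))

    forced-at : ∀ m′ (σ φ : FinMap n) i → lookup φ i ≡ forcedφ (lookup σ i) i → AdmissibleAt m′ σ φ i
    forced-at m′ σ φ i φi≡ rewrite φi≡ = forcedφ-capelliAt (lookup σ i) i , forcedφ-inCmAt m′ (lookup σ i) i

    InC-swapReset : ∀ {σ φ : FinMap n} → InC m₀ σ φ → InC m₁ (swapPositions σ) (resetφ σ φ)
    InC-swapReset {σ} {φ} c =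
      InC-patch c (swapPositions-injective σ (InC.injective c)) (swapPositions-other σ) (resetφ-other σ φ) inCmAt-m₀⇒m₁ patched
      where
      patched : ∀ i → i ≡ j ⊎ i ≡ μF → AdmissibleAt m₁ (swapPositions σ) (resetφ σ φ) i
      patched .j (inj₁ refl) = forced-at m₁ (swapPositions σ) (resetφ σ φ) j (resetφ-j σ φ)
      patched .μF (inj₂ refl) = forced-at m₁ (swapPositions σ) (resetφ σ φ) μF (resetφ-μ σ φ)

    InC-swapMark : ∀ {σ φ : FinMap n} → InC m₁ σ φ → lookup σ j ≡ μF → InC m₀ (swapPositions σ) (markφ σ φ)
    InC-swapMark {σ} {φ} c σj≡μ =
      InC-patch c (swapPositions-injective σ (InC.injective c)) (swapPositions-other σ) (markφ-other σ φ)
        (λ s f _ _ → inCmAt-antitone (NP.n≤1+n m₀) s f _) patched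
      where
      σ′μ≡μ : lookup (swapPositions σ) μF ≡ μF
      σ′μ≡μ = trans (swapPositions-μ σ) σj≡μ
      patched : ∀ i → i ≡ j ⊎ i ≡ μF → AdmissibleAt m₀ (swapPositions σ) (markφ σ φ) i
      patched .j (inj₁ refl) = forced-at m₀ (swapPositions σ) (markφ σ φ) j (markφ-j σ φ)
      patched .μF (inj₂ refl) rewrite σ′μ≡μ | markφ-μ σ φ | eqF-refl μF =
        ⌊⌋-true (toℕ j ℕ.≤? μ) (NP.<⇒≤ j<μ) , trans (cong (not (ltF j μF) ∨_) (⌊⌋-true (m₀ ℕ.≤? suc μ) NP.≤-refl)) (BP.∨-zeroʳ _)

    FinMap-ext-j-μ : ∀ {φ φ′ : FinMap n} → lookup φ′ j ≡ lookup φ j → lookup φ′ μF ≡ lookup φ μF →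
                     (∀ {i} → i ≢ j → i ≢ μF → lookup φ′ i ≡ lookup φ i) → φ′ ≡ φ
    FinMap-ext-j-μ {φ} {φ′} at-j at-μ elsewhere = vec-ext λ i → by-cases i (i ≟F j) (i ≟F μF)
      where
      by-cases : ∀ i → Dec (i ≡ j) → Dec (i ≡ μF) → lookup φ′ i ≡ lookup φ i
      by-cases i (yes refl) _ = at-j
      by-cases i (no _) (yes refl) = at-μ
      by-cases i (no i≢j) (no i≢μ) = elsewhere i≢j i≢μ

    forced-after-double-swap : ∀ σ φ i → lookup φ i ≡ forcedφ (lookup σ i) i →
                               forcedφ (lookup (swapPositions (swapPositions σ)) i) i ≡ lookup φ i
    forced-after-double-swap σ φ i φi≡ = trans (cong (λ σ′ → forcedφ (lookup σ′ i) i) (swapPositions-involutive σ)) (sym φi≡)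

    swapReset-involutive : ∀ {σ φ : FinMap n} → InC m₁ σ φ → swapReset (swapReset (σ , φ)) ≡ (σ , φ)
    swapReset-involutive {σ} {φ} c = cong₂ _,_ (swapPositions-involutive σ) (FinMap-ext-j-μ
      (trans (resetφ-j (swapPositions σ) (resetφ σ φ)) (forced-after-double-swap σ φ j (InC-forced c j j-below-m₁)))
      (trans (resetφ-μ (swapPositions σ) (resetφ σ φ)) (forced-after-double-swap σ φ μF (InC-forced c μF μ-below-m₁)))
      (λ i≢j i≢μ → trans (resetφ-other (swapPositions σ) (resetφ σ φ) i≢j i≢μ) (resetφ-other σ φ i≢j i≢μ)))

    swapMark-swapReset : ∀ {σ φ : FinMap n} → InC m₀ σ φ → lookup φ μF ≡ j → swapMark (swapReset (σ , φ)) ≡ (σ , φ)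
    swapMark-swapReset {σ} {φ} c φμ≡j = cong₂ _,_ (swapPositions-involutive σ) (FinMap-ext-j-μ
      (trans (markφ-j (swapPositions σ) (resetφ σ φ)) (forced-after-double-swap σ φ j (InC-forced c j j-below-m₀)))
      (trans (markφ-μ (swapPositions σ) (resetφ σ φ)) (sym φμ≡j))
      (λ i≢j i≢μ → trans (markφ-other (swapPositions σ) (resetφ σ φ) i≢j i≢μ) (resetφ-other σ φ i≢j i≢μ)))

    swapReset-swapMark : ∀ {σ φ : FinMap n} → InC m₁ σ φ → swapReset (swapMark (σ , φ)) ≡ (σ , φ)
    swapReset-swapMark {σ} {φ} c = cong₂ _,_ (swapPositions-involutive σ) (FinMap-ext-j-μ
      (trans (resetφ-j (swapPositions σ) (markφ σ φ)) (forced-after-double-swap σ φ j (InC-forced c j j-below-m₁)))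
      (trans (resetφ-μ (swapPositions σ) (markφ σ φ)) (forced-after-double-swap σ φ μF (InC-forced c μF μ-below-m₁)))
      (λ i≢j i≢μ → trans (resetφ-other (swapPositions σ) (markφ σ φ) i≢j i≢μ) (markφ-other σ φ i≢j i≢μ)))

    swapMark-∉C[m₁] : ∀ {σ φ : FinMap n} → lookup σ j ≡ μF → memberC m₁ (swapPositions σ) (markφ σ φ) ≡ false
    swapMark-∉C[m₁] {σ} {φ} σj≡μ =
      trans (cong (isCapelli (swapPositions σ) (markφ σ φ) ∧_) (allB-false _ μF fails-at-μ)) (BP.∧-zeroʳ _)
      where
      fails-at-μ : inCmAt m₁ (lookup (swapPositions σ) μF) (lookup (markφ σ φ) μF) μF ≡ false
      fails-at-μ rewrite swapPositions-μ σ | σj≡μ | markφ-μ σ φ | eqF-refl μF | ltF-< j<μ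
                       | ⌊⌋-false (m₁ ℕ.≤? suc μ) μ-below-m₁ = refl

module FiniteSums {c ℓ} (R : CommutativeRing c ℓ) where
  open CommutativeRing R
  open import Relation.Binary.Reasoning.Setoid setoid
  open import Algebra.Properties.CommutativeSemigroup +-commutativeSemigroup using (interchange)
  open import Algebra.Properties.CommutativeSemigroup *-commutativeSemigroup using (x∙yz≈y∙xz) public

  private variable
    a : Level.Level
    X Y : Set a

  ∑ : List X → (X → Carrier) → Carrier
  ∑ xs g = sumR R (map g xs)

  when : Bool → Carrier → Carrier
  when b x = if b then x else 0#

  when-cong : ∀ b {x y} → x ≈ y → when b x ≈ when b y
  when-cong true x≈y = x≈y
  when-cong false _ = refl

  *-when : ∀ b x y → x * when b y ≈ when b (x * y)
  *-when true x y = refl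
  *-when false x y = zeroʳ x

  when-when : ∀ b b′ x → when b (when b′ x) ≡ when (b ∧ b′) x
  when-when true b′ x = P.refl
  when-when false b′ x = P.refl

  when-+ : ∀ b x y → when b (x + y) ≈ when b x + when b y
  when-+ true x y = refl
  when-+ false x y = sym (+-identityˡ 0#)

  ∑-cong : ∀ (xs : List X) {g h} → (∀ x → g x ≈ h x) → ∑ xs g ≈ ∑ xs h
  ∑-cong [] _ = refl
  ∑-cong (x ∷ xs) g≈h = +-cong (g≈h x) (∑-cong xs g≈h)

  ∑-congᴬ : ∀ {xs : List X} {g h} → All (λ x → g x ≈ h x) xs → ∑ xs g ≈ ∑ xs h
  ∑-congᴬ [] = refl
  ∑-congᴬ (gx≈hx ∷ rest) = +-cong gx≈hx (∑-congᴬ rest)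

  ∑-zero : ∀ (xs : List X) {g} → (∀ x → g x ≈ 0#) → ∑ xs g ≈ 0#
  ∑-zero [] _ = refl
  ∑-zero (x ∷ xs) g≈0 = trans (+-cong (g≈0 x) (∑-zero xs g≈0)) (+-identityˡ 0#)

  ∑-+ : ∀ (xs : List X) (g h : X → Carrier) → ∑ xs (λ x → g x + h x) ≈ ∑ xs g + ∑ xs h
  ∑-+ [] g h = sym (+-identityˡ 0#)
  ∑-+ (x ∷ xs) g h = trans (+-cong refl (∑-+ xs g h)) (interchange _ _ _ _)

  *-∑ : ∀ (xs : List X) k (g : X → Carrier) → k * ∑ xs g ≈ ∑ xs (λ x → k * g x)
  *-∑ [] k g = zeroʳ k
  *-∑ (x ∷ xs) k g = trans (distribˡ k _ _) (+-cong refl (*-∑ xs k g))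

  when-∑ : ∀ (xs : List X) b (g : X → Carrier) → when b (∑ xs g) ≈ ∑ xs (λ x → when b (g x))
  when-∑ xs true g = refl
  when-∑ xs false g = sym (∑-zero xs (λ _ → refl))

  ∑-swap : ∀ (xs : List X) (ys : List Y) (g : X → Y → Carrier) →
           ∑ xs (λ x → ∑ ys (g x)) ≈ ∑ ys (λ y → ∑ xs (λ x → g x y))
  ∑-swap [] ys g = sym (∑-zero ys (λ _ → refl))
  ∑-swap (x ∷ xs) ys g = begin
    ∑ ys (g x) + ∑ xs (λ x → ∑ ys (g x))              ≈⟨ +-cong refl (∑-swap xs ys g) ⟩
    ∑ ys (g x) + ∑ ys (λ y → ∑ xs (λ x → g x y))      ≈⟨ sym (∑-+ ys (g x) _) ⟩
    ∑ ys (λ y → g x y + ∑ xs (λ x → g x y))           ∎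

  sumR-++ : ∀ (xs ys : List Carrier) → sumR R (xs ++ ys) ≈ sumR R xs + sumR R ys
  sumR-++ [] ys = sym (+-identityˡ _)
  sumR-++ (x ∷ xs) ys = trans (+-cong refl (sumR-++ xs ys)) (sym (+-assoc _ _ _))

  ∑-++ : ∀ (xs ys : List X) (g : X → Carrier) → ∑ (xs ++ ys) g ≈ ∑ xs g + ∑ ys g
  ∑-++ xs ys g = trans (reflexive (P.cong (sumR R) (LP.map-++ g xs ys))) (sumR-++ (map g xs) (map g ys))

  sumR-concatMap : ∀ (f : X → List Carrier) xs → sumR R (concatMap f xs) ≈ ∑ xs (λ x → sumR R (f x))
  sumR-concatMap f [] = refl
  sumR-concatMap f (x ∷ xs) = trans (sumR-++ (f x) _) (+-cong refl (sumR-concatMap f xs))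

  ∑-concatMap : ∀ (f : X → List Y) xs (g : Y → Carrier) → ∑ (concatMap f xs) g ≈ ∑ xs (λ x → ∑ (f x) g)
  ∑-concatMap f [] g = refl
  ∑-concatMap f (x ∷ xs) g = trans (∑-++ (f x) _ g) (+-cong refl (∑-concatMap f xs g))

  ∑-map : ∀ (f : X → Y) xs (g : Y → Carrier) → ∑ (map f xs) g ≡ ∑ xs (g ∘ f)
  ∑-map f xs g = P.cong (sumR R) (P.sym (LP.map-∘ xs))

  ∑-allFin-suc : ∀ n (g : Fin (suc n) → Carrier) → ∑ (allFin (suc n)) g ≈ g F.zero + ∑ (allFin n) (g ∘ F.suc)
  ∑-allFin-suc n g = +-cong refl (reflexive (P.cong (sumR R)
    (P.trans (LP.map-tabulate F.suc g) (P.sym (LP.map-tabulate id (g ∘ F.suc))))))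

  ∑-δ : ∀ {n} (i : Fin n) (g : Fin n → Carrier) → ∑ (allFin n) (λ k → when (eqF k i) (g k)) ≈ g i
  ∑-δ {suc n} F.zero g = begin
    ∑ (allFin (suc n)) (λ k → when (eqF k F.zero) (g k))        ≈⟨ ∑-allFin-suc n _ ⟩
    g F.zero + ∑ (allFin n) (λ _ → 0#)                           ≈⟨ +-cong refl (∑-zero (allFin n) (λ _ → refl)) ⟩
    g F.zero + 0#                                                ≈⟨ +-identityʳ _ ⟩
    g F.zero                                                     ∎
  ∑-δ {suc n} (F.suc i) g = begin
    ∑ (allFin (suc n)) (λ k → when (eqF k (F.suc i)) (g k))     ≈⟨ ∑-allFin-suc n _ ⟩
    0# + ∑ (allFin n) (λ k → when (eqF (F.suc k) (F.suc i)) (g (F.suc k)))  ≈⟨ +-identityˡ _ ⟩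
    ∑ (allFin n) (λ k → when (eqF (F.suc k) (F.suc i)) (g (F.suc k)))
      ≈⟨ ∑-cong (allFin n) (λ k → reflexive (P.cong (λ b → when b (g (F.suc k))) (eqF-suc k i))) ⟩
    ∑ (allFin n) (λ k → when (eqF k i) (g (F.suc k)))           ≈⟨ ∑-δ i (g ∘ F.suc) ⟩
    g (F.suc i)                                                  ∎

  ∑-δ′ : ∀ {n} (i : Fin n) (g : Fin n → Carrier) → ∑ (allFin n) (λ k → when (eqF i k) (g k)) ≈ g i
  ∑-δ′ i g = trans (∑-cong (allFin _) (λ k → reflexive (P.cong (λ b → when b (g k)) (eqF-sym i k)))) (∑-δ i g)

module DifferentialOperators {c ℓ} (R : CommutativeRing c ℓ) where
  open CommutativeRing R
  open import Relation.Binary.Reasoning.Setoid setoid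
  open P using (_≡_) renaming (refl to ≡-refl; sym to ≡-sym; trans to ≡-trans; cong to ≡-cong)
  open FiniteSums R

  Pair : ℕ → Set
  Pair n = Fin n × Fin n

  _≟P_ : ∀ {n} (p q : Pair n) → Dec (p ≡ q)
  (a , b) ≟P (a′ , b′) with a ≟F a′ | b ≟F b′
  ... | yes ≡-refl | yes ≡-refl = yes ≡-refl
  ... | no a≢a′ | _ = no (λ { ≡-refl → a≢a′ ≡-refl })
  ... | yes _ | no b≢b′ = no (λ { ≡-refl → b≢b′ ≡-refl })

  eqP : ∀ {n} → Pair n → Pair n → Bool
  eqP p q = ⌊ p ≟P q ⌋

  expAt : ∀ {n} → Mon n → Pair n → ℕ
  expAt e (a , b) = expo e a b

  updAt : ∀ {n} → Mon n → Pair n → (ℕ → ℕ) → Mon n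
  updAt e (a , b) g = updExp e a b g

  expAt-updAt-same : ∀ {n} (e : Mon n) p g → expAt (updAt e p g) p ≡ g (expAt e p)
  expAt-updAt-same e (a , b) g =
    ≡-trans (≡-cong (λ r → lookup r b) (VP.lookup∘updateAt a e)) (VP.lookup∘updateAt b (lookup e a))

  expAt-updAt-other : ∀ {n} (e : Mon n) p q g → p ≢ q → expAt (updAt e p g) q ≡ expAt e q
  expAt-updAt-other e (a , b) (a′ , b′) g p≢q with a ≟F a′
  ... | yes ≡-refl = ≡-trans (≡-cong (λ r → lookup r b′) (VP.lookup∘updateAt a e))
                             (VP.lookup∘updateAt′ b′ b (λ b′≡b → p≢q (≡-cong (a ,_) (≡-sym b′≡b))) (lookup e a))
  ... | no a≢a′ = ≡-cong (λ r → lookup r b′) (VP.lookup∘updateAt′ a′ a (λ a′≡a → a≢a′ (≡-sym a′≡a)) e)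

  updAt-updAt : ∀ {n} (e : Mon n) p g h → updAt (updAt e p g) p h ≡ updAt e p (h ∘ g)
  updAt-updAt e (a , b) g h =
    ≡-trans (VP.updateAt-updateAt a e) (VP.updateAt-cong a (λ row → VP.updateAt-updateAt b row) e)

  updAt-id : ∀ {n} (e : Mon n) p g → g (expAt e p) ≡ expAt e p → updAt e p g ≡ e
  updAt-id e (a , b) g fixes = VP.updateAt-id-local a e (VP.updateAt-id-local b (lookup e a) fixes)

  updAt-comm : ∀ {n} (e : Mon n) p q g h → p ≢ q → updAt (updAt e p g) q h ≡ updAt (updAt e q h) p g
  updAt-comm e (a , b) (a′ , b′) g h p≢q with a ≟F a′
  ... | yes ≡-refl = ≡-trans (VP.updateAt-updateAt a e)
                      (≡-trans (VP.updateAt-cong a (λ row → ≡-sym (VP.updateAt-commutes b b′ (λ b≡b′ → p≢q (≡-cong (a ,_) b≡b′)) row)) e)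
                        (≡-sym (VP.updateAt-updateAt a e)))
  ... | no a≢a′ = VP.updateAt-commutes a′ a (λ a′≡a → a≢a′ (≡-sym a′≡a)) e

  natMul-cong : ∀ k {x y} → x ≈ y → natMul R k x ≈ natMul R k y
  natMul-cong zero _ = refl
  natMul-cong (suc k) x≈y = +-cong x≈y (natMul-cong k x≈y)

  natMul-+ : ∀ k x y → natMul R k (x + y) ≈ natMul R k x + natMul R k y
  natMul-+ zero x y = sym (+-identityˡ 0#)
  natMul-+ (suc k) x y = trans (+-cong refl (natMul-+ k x y)) (interchange _ _ _ _)
    where open import Algebra.Properties.CommutativeSemigroup +-commutativeSemigroup using (interchange)

  natMul-0# : ∀ k → natMul R k 0# ≈ 0#
  natMul-0# zero = refl
  natMul-0# (suc k) = trans (+-identityˡ _) (natMul-0# k)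

  natMul-* : ∀ k x y → natMul R k (x * y) ≈ x * natMul R k y
  natMul-* zero x y = sym (zeroʳ x)
  natMul-* (suc k) x y = trans (+-cong refl (natMul-* k x y)) (sym (distribˡ x _ _))

  natMul-comm : ∀ k l x → natMul R k (natMul R l x) ≈ natMul R l (natMul R k x)
  natMul-comm k l x = begin
    natMul R k (natMul R l x)            ≈⟨ as-product k _ ⟩
    natMul R l x * natMul R k 1#         ≈⟨ *-congʳ (as-product l x) ⟩
    (x * natMul R l 1#) * natMul R k 1#  ≈⟨ *-assoc _ _ _ ⟩
    x * (natMul R l 1# * natMul R k 1#)  ≈⟨ *-congˡ (*-comm _ _) ⟩
    x * (natMul R k 1# * natMul R l 1#)  ≈⟨ sym (*-assoc _ _ _) ⟩
    (x * natMul R k 1#) * natMul R l 1#  ≈⟨ *-congʳ (sym (as-product k x)) ⟩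
    natMul R k x * natMul R l 1#         ≈⟨ sym (as-product l _) ⟩
    natMul R l (natMul R k x)            ∎
    where
    as-product : ∀ k x → natMul R k x ≈ x * natMul R k 1#
    as-product k x = trans (natMul-cong k (sym (*-identityʳ x))) (natMul-* k x 1#)

  unlessZero : ℕ → Carrier → Carrier
  unlessZero zero _ = 0#
  unlessZero (suc _) x = x

  unlessZero-cong : ∀ k {x y} → x ≈ y → unlessZero k x ≈ unlessZero k y
  unlessZero-cong zero _ = refl
  unlessZero-cong (suc k) x≈y = x≈y

  mulVar : ∀ {n} → Pair n → Op R n
  mulVar p f e = unlessZero (expAt e p) (f (updAt e p ℕ.pred))

  diffVar : ∀ {n} → Pair n → Op R n
  diffVar p f e = natMul R (suc (expAt e p)) (f (updAt e p suc))

  mulX≡mulVar-canon : ∀ {n} (i j : Fin n) f e → mulX R i j f e ≡ mulVar (canon i j) f e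
  mulX≡mulVar-canon i j f e with canon i j
  ... | (a , b) with expo e a b
  ...   | zero = ≡-refl
  ...   | suc _ = ≡-refl

  dX≡diffVar-canon : ∀ {n} (i j : Fin n) f e → dX R i j f e ≡ diffVar (canon i j) f e
  dX≡diffVar-canon i j f e with canon i j
  ... | (a , b) = ≡-refl

  infix 4 _≐_
  _≐_ : ∀ {n} → Poly R n → Poly R n → Set ℓ
  f ≐ g = ∀ e → f e ≈ g e

  record IsLinear {n} (T : Op R n) : Set (c ⊔ ℓ) where
    field
      cong≐ : ∀ {f g} → f ≐ g → T f ≐ T g
      +-hom : ∀ f g → T (λ e → f e + g e) ≐ (λ e → T f e + T g e)
      *-hom : ∀ k f → T (λ e → k * f e) ≐ (λ e → k * T f e)

    0-hom : T (λ _ → 0#) ≐ (λ _ → 0#)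
    0-hom e = trans (cong≐ (λ _ → sym (zeroˡ 0#)) e) (trans (*-hom 0# (λ _ → 0#) e) (zeroˡ _))

    ∑-hom : ∀ {a} {X : Set a} (xs : List X) (F : X → Poly R n) →
            T (λ e → ∑ xs (λ x → F x e)) ≐ (λ e → ∑ xs (λ x → T (F x) e))
    ∑-hom [] F = 0-hom
    ∑-hom (x ∷ xs) F e = trans (+-hom (F x) _ e) (+-cong refl (∑-hom xs F e))

    ∑-*-hom : ∀ {a} {X : Set a} (xs : List X) (k : X → Carrier) (G : X → Poly R n) →
              T (λ e → ∑ xs (λ x → k x * G x e)) ≐ (λ e → ∑ xs (λ x → k x * T (G x) e))
    ∑-*-hom xs k G e = trans (∑-hom xs (λ x e → k x * G x e) e) (∑-cong xs (λ x → *-hom (k x) (G x) e))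

    when-hom : ∀ b f → T (λ e → when b (f e)) ≐ (λ e → when b (T f e))
    when-hom true f e = refl
    when-hom false f e = 0-hom e
  open IsLinear public

  id-linear : ∀ {n} → IsLinear {n} id
  id-linear = record { cong≐ = id ; +-hom = λ _ _ _ → refl ; *-hom = λ _ _ _ → refl }

  ∘-linear : ∀ {n} {T₁ T₂ : Op R n} → IsLinear T₁ → IsLinear T₂ → IsLinear (T₁ ∘ T₂)
  ∘-linear L₁ L₂ = record
    { cong≐ = cong≐ L₁ ∘ cong≐ L₂
    ; +-hom = λ f g e → trans (cong≐ L₁ (+-hom L₂ f g) e) (+-hom L₁ _ _ e)
    ; *-hom = λ k f e → trans (cong≐ L₁ (*-hom L₂ k f) e) (*-hom L₁ _ _ e) }

  mulVar-linear : ∀ {n} (p : Pair n) → IsLinear (mulVar p)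
  mulVar-linear p = record
    { cong≐ = λ f≐g e → unlessZero-cong (expAt e p) (f≐g _)
    ; +-hom = λ f g e → +-hom′ (expAt e p)
    ; *-hom = λ k f e → *-hom′ k (expAt e p) }
    where
    +-hom′ : ∀ m {x y} → unlessZero m (x + y) ≈ unlessZero m x + unlessZero m y
    +-hom′ zero = sym (+-identityˡ 0#)
    +-hom′ (suc m) = refl
    *-hom′ : ∀ k m {x} → unlessZero m (k * x) ≈ k * unlessZero m x
    *-hom′ k zero = sym (zeroʳ k)
    *-hom′ k (suc m) = refl

  diffVar-linear : ∀ {n} (p : Pair n) → IsLinear (diffVar p)
  diffVar-linear p = record
    { cong≐ = λ f≐g e → natMul-cong (suc (expAt e p)) (f≐g _)
    ; +-hom = λ f g e → natMul-+ (suc (expAt e p)) _ _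
    ; *-hom = λ k f e → natMul-* (suc (expAt e p)) k _ }

  mulVar-comm : ∀ {n} (p q : Pair n) f → mulVar p (mulVar q f) ≐ mulVar q (mulVar p f)
  mulVar-comm p q f e with p ≟P q
  ... | yes ≡-refl = refl
  ... | no p≢q rewrite expAt-updAt-other e p q ℕ.pred p≢q
                    | expAt-updAt-other e q p ℕ.pred (λ q≡p → p≢q (≡-sym q≡p))
                    | updAt-comm e p q ℕ.pred ℕ.pred p≢q with expAt e p | expAt e q
  ...   | zero | zero = refl
  ...   | zero | suc _ = refl
  ...   | suc _ | zero = refl
  ...   | suc _ | suc _ = refl

  diffVar-comm : ∀ {n} (p q : Pair n) f → diffVar p (diffVar q f) ≐ diffVar q (diffVar p f)
  diffVar-comm p q f e with p ≟P q
  ... | yes ≡-refl = refl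
  ... | no p≢q rewrite expAt-updAt-other e p q suc p≢q
                    | expAt-updAt-other e q p suc (λ q≡p → p≢q (≡-sym q≡p))
                    | updAt-comm e p q suc suc p≢q = natMul-comm (suc (expAt e p)) (suc (expAt e q)) _

  diffVar-mulVar : ∀ {n} (p q : Pair n) f → diffVar p (mulVar q f) ≐ (λ e → mulVar q (diffVar p f) e + when (eqP p q) (f e))
  diffVar-mulVar p q f e with p ≟P q
  ... | yes ≡-refl = same
    where
    same : natMul R (suc (expAt e p)) (unlessZero (expAt (updAt e p suc) p) (f (updAt (updAt e p suc) p ℕ.pred)))
           ≈ unlessZero (expAt e p) (natMul R (suc (expAt (updAt e p ℕ.pred) p)) (f (updAt (updAt e p ℕ.pred) p suc))) + f e
    same rewrite expAt-updAt-same e p suc | updAt-updAt e p suc ℕ.pred | updAt-id e p (ℕ.pred ∘ suc) ≡-refl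
      with expAt e p in eq
    ... | zero = trans (+-identityʳ _) (sym (+-identityˡ _))
    ... | suc k rewrite expAt-updAt-same e p ℕ.pred | eq | updAt-updAt e p ℕ.pred suc
                      | updAt-id e p (suc ∘ ℕ.pred) (≡-trans (≡-cong (suc ∘ ℕ.pred) eq) (≡-sym eq)) = +-comm _ _
  ... | no p≢q rewrite expAt-updAt-other e p q suc p≢q with expAt e q in eq
  ...   | zero = +-cong refl (natMul-0# (expAt e p))
  ...   | suc k rewrite expAt-updAt-other e q p ℕ.pred (λ q≡p → p≢q (≡-sym q≡p))
                      | updAt-comm e p q suc ℕ.pred p≢q = sym (+-identityʳ _)

  IsLinear-≡ : ∀ {n} {T T′ : Op R n} → (∀ f e → T f e ≡ T′ f e) → IsLinear T′ → IsLinear T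
  IsLinear-≡ {T = T} {T′} T≡T′ L = record
    { cong≐ = λ {f} {g} f≐g e → trans (reflexive (T≡T′ f e)) (trans (cong≐ L f≐g e) (reflexive (≡-sym (T≡T′ g e))))
    ; +-hom = λ f g e → trans (reflexive (T≡T′ _ e)) (trans (+-hom L f g e) (+-cong (reflexive (≡-sym (T≡T′ f e))) (reflexive (≡-sym (T≡T′ g e)))))
    ; *-hom = λ k f e → trans (reflexive (T≡T′ _ e)) (trans (*-hom L k f e) (*-congˡ (reflexive (≡-sym (T≡T′ f e))))) }

module SymmetricVariables {c ℓ} (R : CommutativeRing c ℓ) where
  open CommutativeRing R
  open import Relation.Binary.Reasoning.Setoid setoid
  open P using (_≡_) renaming (refl to ≡-refl; sym to ≡-sym; trans to ≡-trans; cong to ≡-cong)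
  open FiniteSums R
  open DifferentialOperators R

  canon-sym : ∀ {n} (i j : Fin n) → canon i j ≡ canon j i
  canon-sym i j with toℕ i ℕ.≤? toℕ j | toℕ j ℕ.≤? toℕ i
  ... | yes i≤j | yes j≤i with toℕ-injective (NP.≤-antisym i≤j j≤i)
  ...   | ≡-refl = ≡-refl
  canon-sym i j | yes _ | no _ = ≡-refl
  canon-sym i j | no _ | yes _ = ≡-refl
  canon-sym i j | no i≰j | no j≰i = ⊥-elim (i≰j (NP.<⇒≤ (NP.≰⇒> j≰i)))

  canon-injective : ∀ {n} (b k a l : Fin n) → canon b k ≡ canon a l → (b ≡ a × k ≡ l) ⊎ (b ≡ l × k ≡ a)
  canon-injective b k a l eq with toℕ b ℕ.≤? toℕ k | toℕ a ℕ.≤? toℕ l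
  canon-injective b k a l ≡-refl | yes _ | yes _ = inj₁ (≡-refl , ≡-refl)
  canon-injective b k a l ≡-refl | yes _ | no _ = inj₂ (≡-refl , ≡-refl)
  canon-injective b k a l ≡-refl | no _ | yes _ = inj₂ (≡-refl , ≡-refl)
  canon-injective b k a l ≡-refl | no _ | no _ = inj₁ (≡-refl , ≡-refl)

  eqP-canon : ∀ {n} (b k a l : Fin n) → eqP (canon b k) (canon a l) ≡ (eqF b a ∧ eqF k l) ∨ (eqF b l ∧ eqF k a)
  eqP-canon b k a l with canon b k ≟P canon a l
  ... | yes eq with canon-injective b k a l eq
  ...   | inj₁ (≡-refl , ≡-refl) rewrite eqF-refl b | eqF-refl k = ≡-refl
  ...   | inj₂ (≡-refl , ≡-refl) rewrite eqF-refl b | eqF-refl k = ≡-sym (BP.∨-zeroʳ _)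
  eqP-canon b k a l | no canon≢ = ≡-sym (∨-false (same-false ≡-refl) (crossed-false ≡-refl))
    where
    ∨-false : ∀ {x y} → x ≡ false → y ≡ false → x ∨ y ≡ false
    ∨-false ≡-refl ≡-refl = ≡-refl
    same-false : ∀ {z} → z ≡ eqF b a ∧ eqF k l → z ≡ false
    same-false {false} _ = ≡-refl
    same-false {true} e with ∧-true⁻ (≡-sym e)
    ... | b≡a , k≡l with eqF-sound {i = b} b≡a | eqF-sound {i = k} k≡l
    ...   | ≡-refl | ≡-refl = ⊥-elim (canon≢ ≡-refl)
    crossed-false : ∀ {z} → z ≡ eqF b l ∧ eqF k a → z ≡ false
    crossed-false {false} _ = ≡-refl
    crossed-false {true} e with ∧-true⁻ (≡-sym e)
    ... | b≡l , k≡a with eqF-sound {i = b} b≡l | eqF-sound {i = k} k≡a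
    ...   | ≡-refl | ≡-refl = ⊥-elim (canon≢ (canon-sym b k))

  -- The weight 1 + δ_{bk} in Σ_{ab} compensates for x_{bb} being a single
  -- variable: weighted, ∂/∂x_{bk} x_{al} acts as δ_{ba}δ_{kl} + δ_{bl}δ_{ka}.
  coef-δ-canon : ∀ {n} (b k a l : Fin n) x →
    coef R b k * when (eqP (canon b k) (canon a l)) x ≈ when (eqF b a ∧ eqF k l) x + when (eqF b l ∧ eqF k a) x
  coef-δ-canon b k a l x rewrite eqP-canon b k a l with b ≟F k
  ... | yes ≡-refl = diagonal (eqF b a) (eqF b l)
    where
    diagonal : ∀ u v → (1# + 1#) * when ((u ∧ v) ∨ (v ∧ u)) x ≈ when (u ∧ v) x + when (v ∧ u) x
    diagonal true true = trans (distribʳ x 1# 1#) (+-cong (*-identityˡ x) (*-identityˡ x))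
    diagonal true false = trans (zeroʳ _) (sym (+-identityˡ 0#))
    diagonal false true = trans (zeroʳ _) (sym (+-identityˡ 0#))
    diagonal false false = trans (zeroʳ _) (sym (+-identityˡ 0#))
  ... | no b≢k = trans (*-identityˡ _) (off-diagonal (eqF b a ∧ eqF k l) (eqF b l ∧ eqF k a) ≡-refl ≡-refl)
    where
    off-diagonal : ∀ u v → u ≡ eqF b a ∧ eqF k l → v ≡ eqF b l ∧ eqF k a → when (u ∨ v) x ≈ when u x + when v x
    off-diagonal false false _ _ = sym (+-identityˡ 0#)
    off-diagonal false true _ _ = sym (+-identityˡ x)
    off-diagonal true false _ _ = sym (+-identityʳ x)
    off-diagonal true true u≡ v≡ with ∧-true⁻ (≡-sym u≡) | ∧-true⁻ (≡-sym v≡)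
    ... | (b≡a , k≡l) | (b≡l , _) with eqF-sound {i = b} b≡a | eqF-sound {i = k} k≡l | eqF-sound {i = b} b≡l
    ...   | ≡-refl | ≡-refl | ≡-refl = ⊥-elim (b≢k ≡-refl)

  module _ {n : ℕ} where
    X D : Fin n → Fin n → Op R n
    X = mulX R
    D = dX R

    X-linear : ∀ i j → IsLinear (X i j)
    X-linear i j = IsLinear-≡ (mulX≡mulVar-canon i j) (mulVar-linear (canon i j))

    D-linear : ∀ i j → IsLinear (D i j)
    D-linear i j = IsLinear-≡ (dX≡diffVar-canon i j) (diffVar-linear (canon i j))

    X-sym : ∀ i j f e → X i j f e ≡ X j i f e
    X-sym i j f e = ≡-trans (mulX≡mulVar-canon i j f e)
      (≡-trans (≡-cong (λ p → mulVar p f e) (canon-sym i j)) (≡-sym (mulX≡mulVar-canon j i f e)))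

    X-comm : ∀ i j k l f → X i j (X k l f) ≐ X k l (X i j f)
    X-comm i j k l f e = begin
      X i j (X k l f) e                              ≡⟨ mulX≡mulVar-canon i j (X k l f) e ⟩
      mulVar (canon i j) (X k l f) e
        ≈⟨ cong≐ (mulVar-linear (canon i j)) (λ e → reflexive (mulX≡mulVar-canon k l f e)) e ⟩
      mulVar (canon i j) (mulVar (canon k l) f) e    ≈⟨ mulVar-comm (canon i j) (canon k l) f e ⟩
      mulVar (canon k l) (mulVar (canon i j) f) e
        ≈⟨ cong≐ (mulVar-linear (canon k l)) (λ e → reflexive (≡-sym (mulX≡mulVar-canon i j f e))) e ⟩
      mulVar (canon k l) (X i j f) e                 ≡⟨ ≡-sym (mulX≡mulVar-canon k l (X i j f) e) ⟩
      X k l (X i j f) e                              ∎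

    D-comm : ∀ i j k l f → D i j (D k l f) ≐ D k l (D i j f)
    D-comm i j k l f e = begin
      D i j (D k l f) e                                ≡⟨ dX≡diffVar-canon i j (D k l f) e ⟩
      diffVar (canon i j) (D k l f) e
        ≈⟨ cong≐ (diffVar-linear (canon i j)) (λ e → reflexive (dX≡diffVar-canon k l f e)) e ⟩
      diffVar (canon i j) (diffVar (canon k l) f) e    ≈⟨ diffVar-comm (canon i j) (canon k l) f e ⟩
      diffVar (canon k l) (diffVar (canon i j) f) e
        ≈⟨ cong≐ (diffVar-linear (canon k l)) (λ e → reflexive (≡-sym (dX≡diffVar-canon i j f e))) e ⟩
      diffVar (canon k l) (D i j f) e                  ≡⟨ ≡-sym (dX≡diffVar-canon k l (D i j f) e) ⟩
      D k l (D i j f) e                                ∎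

    D-X : ∀ b k a l f → D b k (X a l f) ≐ (λ e → X a l (D b k f) e + when (eqP (canon b k) (canon a l)) (f e))
    D-X b k a l f e = begin
      D b k (X a l f) e                                ≡⟨ dX≡diffVar-canon b k (X a l f) e ⟩
      diffVar (canon b k) (X a l f) e
        ≈⟨ cong≐ (diffVar-linear (canon b k)) (λ e → reflexive (mulX≡mulVar-canon a l f e)) e ⟩
      diffVar (canon b k) (mulVar (canon a l) f) e     ≈⟨ diffVar-mulVar (canon b k) (canon a l) f e ⟩
      mulVar (canon a l) (diffVar (canon b k) f) e + δ
        ≈⟨ +-cong (cong≐ (mulVar-linear (canon a l)) (λ e → reflexive (≡-sym (dX≡diffVar-canon b k f e))) e) refl ⟩
      mulVar (canon a l) (D b k f) e + δ               ≡⟨ ≡-cong (_+ δ) (≡-sym (mulX≡mulVar-canon a l (D b k f) e)) ⟩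
      X a l (D b k f) e + δ                            ∎
      where δ = when (eqP (canon b k) (canon a l)) (f e)

module NormalOrdering {c ℓ} (R : CommutativeRing c ℓ) where
  open CommutativeRing R
  open import Relation.Binary.Reasoning.Setoid setoid
  open FiniteSums R
  open DifferentialOperators R
  open SymmetricVariables R

  module _ {n : ℕ} where
    factor : Pair n → Op R n → Op R n
    factor (a , b) T f e = ∑ (allFin n) (λ k → coef R b k * X a k (T (D b k f)) e)

    N : List (Pair n) → Op R n
    N = normalOrd R

    factor-linear : ∀ p {T} → IsLinear T → IsLinear (factor p T)
    factor-linear (a , b) {T} TL = record
      { cong≐ = λ f≐g e → ∑-cong (allFin n) (λ k → *-congˡ (cong≐ (XTD k) f≐g e))
      ; +-hom = λ f g e → trans (∑-cong (allFin n) (λ k → trans (*-congˡ (+-hom (XTD k) f g e)) (distribˡ _ _ _))) (∑-+ (allFin n) _ _)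
      ; *-hom = λ κ f e → trans (∑-cong (allFin n) (λ k → trans (*-congˡ (*-hom (XTD k) κ f e)) (x∙yz≈y∙xz _ _ _))) (sym (*-∑ (allFin n) κ _)) }
      where
      XTD : ∀ k → IsLinear (X a k ∘ T ∘ D b k)
      XTD k = ∘-linear (X-linear a k) (∘-linear TL (D-linear b k))

    normalOrd-linear : ∀ L → IsLinear (N L)
    normalOrd-linear [] = id-linear
    normalOrd-linear ((a , b) ∷ L) = factor-linear (a , b) (normalOrd-linear L)

    factor-cong : ∀ p {T T′} → (∀ g → T g ≐ T′ g) → ∀ f → factor p T f ≐ factor p T′ f
    factor-cong (a , b) eq f e = ∑-cong (allFin n) (λ k → *-congˡ (cong≐ (X-linear a k) (eq _) e))

    XX-T-DD-swap : ∀ {T : Op R n} → IsLinear T → ∀ a k a′ l b k′ b′ l′ f →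
                   X a k (X a′ l (T (D b′ l′ (D b k′ f)))) ≐ X a′ l (X a k (T (D b k′ (D b′ l′ f))))
    XX-T-DD-swap TL a k a′ l b k′ b′ l′ f e =
      trans (X-comm a k a′ l _ e) (cong≐ (X-linear a′ l) (cong≐ (X-linear a k) (cong≐ TL (D-comm b′ l′ b k′ f))) e)

    factor-factor : ∀ a b a′ b′ {T} → IsLinear T → ∀ f e →
      factor (a , b) (factor (a′ , b′) T) f e ≈
        ∑ (allFin n) (λ k → ∑ (allFin n) (λ l → coef R b k * (coef R b′ l * X a k (X a′ l (T (D b′ l (D b k f)))) e)))
    factor-factor a b a′ b′ TL f e = ∑-cong (allFin n) (λ k → trans (*-congˡ (∑-*-hom (X-linear a k) (allFin n) (coef R b′) _ e)) (*-∑ (allFin n) _ _))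

    factor-swap : ∀ p q {T} → IsLinear T → ∀ f → factor p (factor q T) f ≐ factor q (factor p T) f
    factor-swap (a , b) (a′ , b′) {T} TL f e = begin
      factor (a , b) (factor (a′ , b′) T) f e ≈⟨ factor-factor a b a′ b′ TL f e ⟩
      ∑ (allFin n) (λ k → ∑ (allFin n) (λ l → coef R b k * (coef R b′ l * X a k (X a′ l (T (D b′ l (D b k f)))) e)))
        ≈⟨ ∑-swap (allFin n) (allFin n) _ ⟩
      ∑ (allFin n) (λ l → ∑ (allFin n) (λ k → coef R b k * (coef R b′ l * X a k (X a′ l (T (D b′ l (D b k f)))) e)))
        ≈⟨ ∑-cong (allFin n) (λ l → ∑-cong (allFin n) (λ k → trans (x∙yz≈y∙xz _ _ _) (*-congˡ (*-congˡ (XX-T-DD-swap TL a k a′ l b k b′ l f e))))) ⟩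
      ∑ (allFin n) (λ l → ∑ (allFin n) (λ k → coef R b′ l * (coef R b k * X a′ l (X a k (T (D b k (D b′ l f)))) e)))
        ≈⟨ sym (factor-factor a′ b′ a b TL f e) ⟩
      factor (a′ , b′) (factor (a , b) T) f e ∎

    normalOrd-swap : ∀ p q L f → N (p ∷ q ∷ L) f ≐ N (q ∷ p ∷ L) f
    normalOrd-swap p q L = factor-swap p q (normalOrd-linear L)

    normalOrd-snoc : ∀ L p f → N (L ++ p ∷ []) f ≐ N (p ∷ L) f
    normalOrd-snoc [] p f e = refl
    normalOrd-snoc (q ∷ L) p f e = trans (factor-cong q (λ g → normalOrd-snoc L p g) f e) (normalOrd-swap q p L f e)

    factor-+ : ∀ p (T₁ T₂ : Op R n) f → factor p (λ g e → T₁ g e + T₂ g e) f ≐ (λ e → factor p T₁ f e + factor p T₂ f e)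
    factor-+ (a , b) T₁ T₂ f e = trans (∑-cong (allFin n) (λ k → trans (*-congˡ (+-hom (X-linear a k) _ _ e)) (distribˡ _ _ _))) (∑-+ (allFin n) _ _)

    factor-∑ : ∀ p {a′} {Y : Set a′} (ys : List Y) (U : Y → Op R n) f →
      factor p (λ g e → ∑ ys (λ y → U y g e)) f ≐ (λ e → ∑ ys (λ y → factor p (U y) f e))
    factor-∑ (a , b) ys U f e = begin
      ∑ (allFin n) (λ k → coef R b k * X a k (λ e′ → ∑ ys (λ y → U y (D b k f) e′)) e)
        ≈⟨ ∑-cong (allFin n) (λ k → *-congˡ (∑-hom (X-linear a k) ys (λ y → U y (D b k f)) e)) ⟩
      ∑ (allFin n) (λ k → coef R b k * ∑ ys (λ y → X a k (U y (D b k f)) e)) ≈⟨ ∑-cong (allFin n) (λ k → *-∑ ys _ _) ⟩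
      ∑ (allFin n) (λ k → ∑ ys (λ y → coef R b k * X a k (U y (D b k f)) e)) ≈⟨ ∑-swap (allFin n) ys _ ⟩
      ∑ ys (λ y → factor (a , b) (U y) f e) ∎

    factor-when : ∀ p β (T : Op R n) f → factor p (λ g e → when β (T g e)) f ≐ (λ e → when β (factor p T f e))
    factor-when (a , b) β T f e = trans (∑-cong (allFin n) (λ k → trans (*-congˡ (when-hom (X-linear a k) β _ e)) (*-when β _ _))) (sym (when-∑ (allFin n) β _))

    factor-X : ∀ p κ a′ c′ j b′ {T} → IsLinear T → ∀ f →
      factor p (λ g e → κ * X a′ c′ (T (D j b′ g)) e) f ≐ (λ e → κ * X a′ c′ (factor p T (D j b′ f)) e)
    factor-X (a , b) κ a′ c′ j b′ {T} TL f e = begin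
      ∑ (allFin n) (λ k → coef R b k * X a k (λ e′ → κ * X a′ c′ (T (D j b′ (D b k f))) e′) e)
        ≈⟨ ∑-cong (allFin n) (λ k → *-congˡ (*-hom (X-linear a k) κ _ e)) ⟩
      ∑ (allFin n) (λ k → coef R b k * (κ * X a k (X a′ c′ (T (D j b′ (D b k f)))) e))
        ≈⟨ ∑-cong (allFin n) (λ k → trans (x∙yz≈y∙xz _ _ _) (*-congˡ (*-congˡ (XX-T-DD-swap TL a k a′ c′ b k j b′ f e)))) ⟩
      ∑ (allFin n) (λ k → κ * (coef R b k * X a′ c′ (X a k (T (D b k (D j b′ f)))) e)) ≈⟨ sym (*-∑ (allFin n) κ _) ⟩
      κ * ∑ (allFin n) (λ k → coef R b k * X a′ c′ (X a k (T (D b k (D j b′ f)))) e)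
        ≈⟨ *-congˡ (sym (∑-*-hom (X-linear a′ c′) (allFin n) (coef R b) _ e)) ⟩
      κ * X a′ c′ (factor (a , b) T (D j b′ f)) e ∎

module CapelliCommutation {c ℓ} (R : CommutativeRing c ℓ) where
  open CommutativeRing R
  open import Relation.Binary.Reasoning.Setoid setoid
  open P using (_≡_) renaming (refl to ≡-refl; sym to ≡-sym; trans to ≡-trans; cong to ≡-cong; cong₂ to ≡-cong₂)
  open FiniteSums R
  open DifferentialOperators R
  open SymmetricVariables R
  open NormalOrdering R

  module _ {n : ℕ} where
    SigmaOp-linear : ∀ (a b : Fin n) → IsLinear (SigmaOp R a b)
    SigmaOp-linear a b = normalOrd-linear ((a , b) ∷ [])

    contraction : Fin n → Fin n → Fin n → Fin n → Op R n → Op R n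
    contraction a b a₁ b₁ T f e = when (eqF b a₁) (factor (a , b₁) T f e) + coef R b₁ b * X a a₁ (T (D b₁ b f)) e

    private
      all = allFin n

      when-∧-* : ∀ β γ κ y → κ * when (β ∧ γ) y ≈ when β (when γ (κ * y))
      when-∧-* true γ κ y = *-when γ κ y
      when-∧-* false γ κ y = zeroʳ κ

    D-factor : ∀ {T : Op R n} → IsLinear T → ∀ b k a₁ b₁ f →
      D b k (factor (a₁ , b₁) T f) ≐ λ e → ∑ all (λ l → coef R b₁ l * X a₁ l (D b k (T (D b₁ l f))) e)
                                         + ∑ all (λ l → coef R b₁ l * when (eqP (canon b k) (canon a₁ l)) (T (D b₁ l f) e))
    D-factor {T} TL b k a₁ b₁ f e = begin
      D b k (factor (a₁ , b₁) T f) e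
        ≈⟨ ∑-*-hom (D-linear b k) all (coef R b₁) (λ l → X a₁ l (T (D b₁ l f))) e ⟩
      ∑ all (λ l → coef R b₁ l * D b k (X a₁ l (T (D b₁ l f))) e)
        ≈⟨ ∑-cong all (λ l → trans (*-congˡ (D-X b k a₁ l (T (D b₁ l f)) e)) (distribˡ _ _ _)) ⟩
      ∑ all (λ l → coef R b₁ l * X a₁ l (D b k (T (D b₁ l f))) e + coef R b₁ l * when (eqP (canon b k) (canon a₁ l)) (T (D b₁ l f) e))
        ≈⟨ ∑-+ all _ _ ⟩
      _ ∎

    SigmaOp-past-factor : ∀ {T : Op R n} a b a₁ b₁ f e →
      ∑ all (λ k → coef R b k * ∑ all (λ l → coef R b₁ l * X a k (X a₁ l (D b k (T (D b₁ l f)))) e))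
        ≈ factor (a₁ , b₁) (SigmaOp R a b ∘ T) f e
    SigmaOp-past-factor {T} a b a₁ b₁ f e = begin
      ∑ all (λ k → coef R b k * ∑ all (λ l → coef R b₁ l * XX k l))
        ≈⟨ ∑-cong all (λ k → *-∑ all (coef R b k) _) ⟩
      ∑ all (λ k → ∑ all (λ l → coef R b k * (coef R b₁ l * XX k l)))
        ≈⟨ ∑-swap all all _ ⟩
      ∑ all (λ l → ∑ all (λ k → coef R b k * (coef R b₁ l * XX k l)))
        ≈⟨ ∑-cong all (λ l → ∑-cong all (λ k → trans (x∙yz≈y∙xz _ _ _) (*-congˡ (*-congˡ (X-comm a k a₁ l _ e))))) ⟩
      ∑ all (λ l → ∑ all (λ k → coef R b₁ l * (coef R b k * X a₁ l (X a k (D b k (T (D b₁ l f)))) e)))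
        ≈⟨ ∑-cong all (λ l → sym (*-∑ all (coef R b₁ l) _)) ⟩
      ∑ all (λ l → coef R b₁ l * ∑ all (λ k → coef R b k * X a₁ l (X a k (D b k (T (D b₁ l f)))) e))
        ≈⟨ ∑-cong all (λ l → *-congˡ (sym (∑-*-hom (X-linear a₁ l) all (coef R b) (λ k → X a k (D b k (T (D b₁ l f)))) e))) ⟩
      factor (a₁ , b₁) (SigmaOp R a b ∘ T) f e ∎
      where
      XX : Fin n → Fin n → Carrier
      XX k l = X a k (X a₁ l (D b k (T (D b₁ l f)))) e

    SigmaOp-contract-factor : ∀ (T : Op R n) a b a₁ b₁ f e →
      ∑ all (λ k → coef R b k * ∑ all (λ l → coef R b₁ l * when (eqP (canon b k) (canon a₁ l)) (X a k (T (D b₁ l f)) e)))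
        ≈ contraction a b a₁ b₁ T f e
    SigmaOp-contract-factor T a b a₁ b₁ f e = begin
      ∑ all (λ k → coef R b k * ∑ all (λ l → coef R b₁ l * when (eqP (canon b k) (canon a₁ l)) (Y k l)))
        ≈⟨ ∑-cong all (λ k → *-∑ all (coef R b k) _) ⟩
      ∑ all (λ k → ∑ all (λ l → coef R b k * (coef R b₁ l * when (eqP (canon b k) (canon a₁ l)) (Y k l))))
        ≈⟨ ∑-cong all (λ k → ∑-cong all (λ l → trans (x∙yz≈y∙xz _ _ _) (*-congˡ (coef-δ-canon b k a₁ l (Y k l))))) ⟩
      ∑ all (λ k → ∑ all (λ l → coef R b₁ l * (when (eqF b a₁ ∧ eqF k l) (Y k l) + when (eqF b l ∧ eqF k a₁) (Y k l))))
        ≈⟨ trans (∑-cong all (λ k → trans (∑-cong all (λ l → distribˡ _ _ _)) (∑-+ all _ _))) (∑-+ all _ _) ⟩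
      ∑ all (λ k → ∑ all (λ l → coef R b₁ l * when (eqF b a₁ ∧ eqF k l) (Y k l)))
        + ∑ all (λ k → ∑ all (λ l → coef R b₁ l * when (eqF b l ∧ eqF k a₁) (Y k l)))
        ≈⟨ +-cong merge cross ⟩
      contraction a b a₁ b₁ T f e ∎
      where
      Y : Fin n → Fin n → Carrier
      Y k l = X a k (T (D b₁ l f)) e
      merge : ∑ all (λ k → ∑ all (λ l → coef R b₁ l * when (eqF b a₁ ∧ eqF k l) (Y k l))) ≈ when (eqF b a₁) (factor (a , b₁) T f e)
      merge = begin
        ∑ all (λ k → ∑ all (λ l → coef R b₁ l * when (eqF b a₁ ∧ eqF k l) (Y k l)))
          ≈⟨ ∑-cong all (λ k → ∑-cong all (λ l → when-∧-* (eqF b a₁) (eqF k l) (coef R b₁ l) (Y k l))) ⟩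
        ∑ all (λ k → ∑ all (λ l → when (eqF b a₁) (when (eqF k l) (coef R b₁ l * Y k l))))
          ≈⟨ ∑-cong all (λ k → sym (when-∑ all (eqF b a₁) _)) ⟩
        ∑ all (λ k → when (eqF b a₁) (∑ all (λ l → when (eqF k l) (coef R b₁ l * Y k l))))
          ≈⟨ ∑-cong all (λ k → when-cong (eqF b a₁) (∑-δ′ k (λ l → coef R b₁ l * Y k l))) ⟩
        ∑ all (λ k → when (eqF b a₁) (coef R b₁ k * Y k k))
          ≈⟨ sym (when-∑ all (eqF b a₁) _) ⟩
        when (eqF b a₁) (factor (a , b₁) T f e) ∎
      cross : ∑ all (λ k → ∑ all (λ l → coef R b₁ l * when (eqF b l ∧ eqF k a₁) (Y k l))) ≈ coef R b₁ b * X a a₁ (T (D b₁ b f)) e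
      cross = begin
        ∑ all (λ k → ∑ all (λ l → coef R b₁ l * when (eqF b l ∧ eqF k a₁) (Y k l)))
          ≈⟨ ∑-cong all (λ k → ∑-cong all (λ l → when-∧-* (eqF b l) (eqF k a₁) (coef R b₁ l) (Y k l))) ⟩
        ∑ all (λ k → ∑ all (λ l → when (eqF b l) (when (eqF k a₁) (coef R b₁ l * Y k l))))
          ≈⟨ ∑-cong all (λ k → ∑-δ′ b (λ l → when (eqF k a₁) (coef R b₁ l * Y k l))) ⟩
        ∑ all (λ k → when (eqF k a₁) (coef R b₁ b * Y k b))
          ≈⟨ ∑-δ a₁ (λ k → coef R b₁ b * Y k b) ⟩
        coef R b₁ b * Y a₁ b ∎

    -- Σ_{ab}(∂) differentiates each x_{a₁ l} of the factor Σ_{a₁b₁} once; by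
    -- coef-δ-canon the resulting δ's merge the two factors into Σ_{a b₁} when
    -- b = a₁, and otherwise leave x_{a a₁} ∂_{b₁ b}.
    SigmaOp-factor : ∀ {T : Op R n} → IsLinear T → ∀ a b a₁ b₁ f →
      SigmaOp R a b (factor (a₁ , b₁) T f) ≐ λ e → factor (a₁ , b₁) (SigmaOp R a b ∘ T) f e + contraction a b a₁ b₁ T f e
    SigmaOp-factor {T} TL a b a₁ b₁ f e = begin
      SigmaOp R a b (factor (a₁ , b₁) T f) e
        ≈⟨ ∑-cong all (λ k → *-congˡ (Leibniz k)) ⟩
      ∑ all (λ k → coef R b k * (A k + B k))
        ≈⟨ trans (∑-cong all (λ k → distribˡ (coef R b k) _ _)) (∑-+ all _ _) ⟩
      ∑ all (λ k → coef R b k * A k) + ∑ all (λ k → coef R b k * B k)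
        ≈⟨ +-cong (SigmaOp-past-factor {T} a b a₁ b₁ f e) (SigmaOp-contract-factor T a b a₁ b₁ f e) ⟩
      factor (a₁ , b₁) (SigmaOp R a b ∘ T) f e + contraction a b a₁ b₁ T f e ∎
      where
      δ : Fin n → Fin n → Bool
      δ k l = eqP (canon b k) (canon a₁ l)
      A B : Fin n → Carrier
      A k = ∑ all (λ l → coef R b₁ l * X a k (X a₁ l (D b k (T (D b₁ l f)))) e)
      B k = ∑ all (λ l → coef R b₁ l * when (δ k l) (X a k (T (D b₁ l f)) e))
      Leibniz : ∀ k → X a k (D b k (factor (a₁ , b₁) T f)) e ≈ A k + B k
      Leibniz k = trans (cong≐ (X-linear a k) (D-factor TL b k a₁ b₁ f) e) (trans (+-hom (X-linear a k) _ _ e)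
        (+-cong (∑-*-hom (X-linear a k) all (coef R b₁) (λ l → X a₁ l (D b k (T (D b₁ l f)))) e)
                (trans (∑-*-hom (X-linear a k) all (coef R b₁) (λ l e → when (δ k l) (T (D b₁ l f) e)) e)
                       (∑-cong all (λ l → *-congˡ (when-hom (X-linear a k) (δ k l) (T (D b₁ l f)) e))))))

    pairsOf : (Fin n → Fin n) → List (Fin n) → List (Pair n)
    pairsOf τ is = map (λ i → (τ i , i)) is

    redirect : (Fin n → Fin n) → Fin n → Fin n → (Fin n → Fin n)
    redirect τ j a i = if eqF i j then a else τ i

    without : Fin n → List (Fin n) → List (Fin n)
    without j is = filterᵇ (λ i → not (eqF i j)) is

    contractionAt : Fin n → Fin n → (Fin n → Fin n) → List (Fin n) → Fin n → Op R n
    contractionAt a b τ is j f e = when (eqF b (τ j)) (N (pairsOf (redirect τ j a) is) f e)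
                                 + coef R j b * X a (τ j) (N (pairsOf τ (without j is)) (D j b f)) e

    contractions : Fin n → Fin n → (Fin n → Fin n) → List (Fin n) → Op R n
    contractions a b τ is f e = ∑ is (λ j → contractionAt a b τ is j f e)

    pairsOf-cong : ∀ {τ τ′} (is : List (Fin n)) → All (λ i → τ i ≡ τ′ i) is → pairsOf τ is ≡ pairsOf τ′ is
    pairsOf-cong [] [] = ≡-refl
    pairsOf-cong (i ∷ is) (p ∷ ps) = ≡-cong₂ _∷_ (≡-cong (_, i) p) (pairsOf-cong is ps)

    redirect-other : ∀ τ j a i → i ≢ j → redirect τ j a i ≡ τ i
    redirect-other τ j a i ne rewrite eqF-≢ ne = ≡-refl

    without-∉ : ∀ j (is : List (Fin n)) → All (λ i → i ≢ j) is → without j is ≡ is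
    without-∉ j [] [] = ≡-refl
    without-∉ j (i ∷ is) (p ∷ ps) rewrite eqF-≢ p = ≡-cong (i ∷_) (without-∉ j is ps)

    without-All : ∀ j {q} {Q : Fin n → Set q} {is} → All Q is → All (λ i → i ≢ j × Q i) (without j is)
    without-All j [] = []
    without-All j {is = i ∷ is} (qi ∷ qs) with i ≟F j
    ... | yes _ = without-All j qs
    ... | no i≢j = (i≢j , qi) ∷ without-All j qs

    contraction-head : ∀ a b τ i is → All (i ≢_) is → ∀ f →
      contraction a b (τ i) i (N (pairsOf τ is)) f ≐ contractionAt a b τ (i ∷ is) i f
    contraction-head a b τ i is i∉is f e =
      +-cong (when-cong (eqF b (τ i)) (reflexive (≡-cong (λ L → N L f e) redirected)))
             (*-congˡ (reflexive (≡-cong (λ js → X a (τ i) (N (pairsOf τ js) (D i b f)) e) (≡-sym removed))))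
      where
      redirected : (a , i) ∷ pairsOf τ is ≡ pairsOf (redirect τ i a) (i ∷ is)
      redirected rewrite eqF-refl i =
        ≡-cong ((a , i) ∷_) (≡-sym (pairsOf-cong is (All.map (λ {x} i≢x → redirect-other τ i a x (≢-sym i≢x)) i∉is)))
      removed : without i (i ∷ is) ≡ is
      removed rewrite eqF-refl i = without-∉ i is (All.map ≢-sym i∉is)

    factor-contractionAt : ∀ a b τ i is j → i ≢ j → ∀ f →
      factor (τ i , i) (contractionAt a b τ is j) f ≐ contractionAt a b τ (i ∷ is) j f
    factor-contractionAt a b τ i is j i≢j f e = begin
      factor p (contractionAt a b τ is j) f e
        ≈⟨ factor-+ p (λ g e → when (eqF b (τ j)) (N merged g e)) (λ g e → coef R j b * X a (τ j) (N crossed (D j b g)) e) f e ⟩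
      factor p (λ g e → when (eqF b (τ j)) (N merged g e)) f e + factor p (λ g e → coef R j b * X a (τ j) (N crossed (D j b g)) e) f e
        ≈⟨ +-cong (factor-when p (eqF b (τ j)) (N merged) f e) (factor-X p (coef R j b) a (τ j) j b (normalOrd-linear crossed) f e) ⟩
      when (eqF b (τ j)) (N (p ∷ merged) f e) + coef R j b * X a (τ j) (N (p ∷ crossed) (D j b f)) e
        ≈⟨ +-cong (when-cong (eqF b (τ j)) (reflexive (≡-cong (λ q → N (q ∷ merged) f e) (≡-cong (_, i) (≡-sym (redirect-other τ j a i i≢j))))))
                  (*-congˡ (reflexive (≡-cong (λ js → X a (τ j) (N (pairsOf τ js) (D j b f)) e) (≡-sym kept)))) ⟩
      contractionAt a b τ (i ∷ is) j f e ∎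
      where
      p = (τ i , i)
      merged = pairsOf (redirect τ j a) is
      crossed = pairsOf τ (without j is)
      kept : without j (i ∷ is) ≡ i ∷ without j is
      kept rewrite eqF-≢ i≢j = ≡-refl

    SigmaOp-normalOrd : ∀ a b τ (is : List (Fin n)) → Unique is → ∀ f →
      SigmaOp R a b (N (pairsOf τ is) f) ≐ (λ e → N ((a , b) ∷ pairsOf τ is) f e + contractions a b τ is f e)
    SigmaOp-normalOrd a b τ [] _ f e = sym (+-identityʳ _)
    SigmaOp-normalOrd a b τ (i ∷ is) (i∉is ∷ unique) f e = begin
      SigmaOp R a b (factor p (N L) f) e
        ≈⟨ SigmaOp-factor (normalOrd-linear L) a b (τ i) i f e ⟩
      factor p (SigmaOp R a b ∘ N L) f e + contraction a b (τ i) i (N L) f e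
        ≈⟨ +-cong (trans (factor-cong p (λ g → SigmaOp-normalOrd a b τ is unique g) f e) (factor-+ p (N ((a , b) ∷ L)) (contractions a b τ is) f e)) refl ⟩
      (factor p (N ((a , b) ∷ L)) f e + factor p (contractions a b τ is) f e) + contraction a b (τ i) i (N L) f e
        ≈⟨ +-assoc _ _ _ ⟩
      factor p (N ((a , b) ∷ L)) f e + (factor p (contractions a b τ is) f e + contraction a b (τ i) i (N L) f e)
        ≈⟨ +-cong (normalOrd-swap p (a , b) L f e) (trans (+-comm _ _) (+-cong (contraction-head a b τ i is i∉is f e) later)) ⟩
      N ((a , b) ∷ pairsOf τ (i ∷ is)) f e + contractions a b τ (i ∷ is) f e ∎
      where
      p = (τ i , i)
      L = pairsOf τ is
      later : factor p (contractions a b τ is) f e ≈ ∑ is (λ j → contractionAt a b τ (i ∷ is) j f e)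
      later = trans (factor-∑ p is (contractionAt a b τ is) f e)
                    (∑-congᴬ (All.map (λ {j} i≢j → factor-contractionAt a b τ i is j i≢j f e) i∉is))

module ConfigurationSums {c ℓ} (R : CommutativeRing c ℓ) where
  open CommutativeRing R
  open import Relation.Binary.Reasoning.Setoid setoid
  open P using (_≡_) renaming (refl to ≡-refl; sym to ≡-sym; trans to ≡-trans; cong to ≡-cong; cong₂ to ≡-cong₂)
  open FiniteSums R
  open V using ([]; _∷_)

  module _ {n : ℕ} where
    eqVec : ∀ {k} → Vec (Fin n) k → Vec (Fin n) k → Bool
    eqVec [] [] = true
    eqVec (x ∷ v) (y ∷ w) = eqF x y ∧ eqVec v w

    eqVec-refl : ∀ {k} (v : Vec (Fin n) k) → eqVec v v ≡ true
    eqVec-refl [] = ≡-refl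
    eqVec-refl (x ∷ v) rewrite eqF-refl x = eqVec-refl v

    eqVec-sound : ∀ {k} {v w : Vec (Fin n) k} → eqVec v w ≡ true → v ≡ w
    eqVec-sound {v = []} {[]} e = ≡-refl
    eqVec-sound {v = x ∷ v} {y ∷ w} e with eqF x y in ex
    ... | true = ≡-cong₂ _∷_ (eqF-sound ex) (eqVec-sound e)

    ∑-vecsOf-δ : ∀ k (z : Vec (Fin n) k) (g : Vec (Fin n) k → Carrier) →
                ∑ (vecsOf (allFin n) k) (λ v → when (eqVec v z) (g v)) ≈ g z
    ∑-vecsOf-δ zero [] g = +-identityʳ _
    ∑-vecsOf-δ (suc k) (z₀ ∷ z) g = begin
      ∑ (vecsOf (allFin n) (suc k)) (λ v → when (eqVec v (z₀ ∷ z)) (g v)) ≈⟨ ∑-concatMap _ (allFin n) _ ⟩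
      ∑ (allFin n) (λ x → ∑ (map (x ∷_) (vecsOf (allFin n) k)) (λ v → when (eqVec v (z₀ ∷ z)) (g v)))
        ≈⟨ ∑-cong (allFin n) (λ x → reflexive (∑-map (x ∷_) (vecsOf (allFin n) k) (λ v → when (eqVec v (z₀ ∷ z)) (g v)))) ⟩
      ∑ (allFin n) (λ x → ∑ (vecsOf (allFin n) k) (λ v → when (eqF x z₀ ∧ eqVec v z) (g (x ∷ v))))
        ≈⟨ ∑-cong (allFin n) (λ x → ∑-cong (vecsOf (allFin n) k) (λ v → reflexive (≡-sym (when-when (eqF x z₀) (eqVec v z) _)))) ⟩
      ∑ (allFin n) (λ x → ∑ (vecsOf (allFin n) k) (λ v → when (eqF x z₀) (when (eqVec v z) (g (x ∷ v)))))
        ≈⟨ ∑-cong (allFin n) (λ x → sym (when-∑ (vecsOf (allFin n) k) (eqF x z₀) _)) ⟩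
      ∑ (allFin n) (λ x → when (eqF x z₀) (∑ (vecsOf (allFin n) k) (λ v → when (eqVec v z) (g (x ∷ v)))))
        ≈⟨ ∑-cong (allFin n) (λ x → when-cong (eqF x z₀) (∑-vecsOf-δ k z (g ∘ (x ∷_)))) ⟩
      ∑ (allFin n) (λ x → when (eqF x z₀) (g (x ∷ z))) ≈⟨ ∑-δ z₀ (λ x → g (x ∷ z)) ⟩
      g (z₀ ∷ z) ∎

    configs : List (FinMap n)
    configs = vecsOf (allFin n) n

    ∑C : (Config n → Carrier) → Carrier
    ∑C G = ∑ configs (λ σ → ∑ configs (λ φ → G (σ , φ)))

    eqConfig : Config n → Config n → Bool
    eqConfig (σ , φ) (σ′ , φ′) = eqVec σ σ′ ∧ eqVec φ φ′

    eqConfig-refl : ∀ x → eqConfig x x ≡ true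
    eqConfig-refl (σ , φ) rewrite eqVec-refl σ = eqVec-refl φ

    eqConfig-sound : ∀ {x y} → eqConfig x y ≡ true → x ≡ y
    eqConfig-sound {σ , φ} {σ′ , φ′} e with eqVec σ σ′ in e1
    ... | true = ≡-cong₂ _,_ (eqVec-sound e1) (eqVec-sound e)

    ∑C-cong : ∀ {G H : Config n → Carrier} → (∀ x → G x ≈ H x) → ∑C G ≈ ∑C H
    ∑C-cong eq = ∑-cong configs (λ σ → ∑-cong configs (λ φ → eq (σ , φ)))

    ∑C-+ : ∀ (G H : Config n → Carrier) → ∑C (λ x → G x + H x) ≈ ∑C G + ∑C H
    ∑C-+ G H = trans (∑-cong configs (λ σ → ∑-+ configs _ _)) (∑-+ configs _ _)

    ∑C-zero : ∀ {G : Config n → Carrier} → (∀ x → G x ≈ 0#) → ∑C G ≈ 0#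
    ∑C-zero eq = ∑-zero configs (λ σ → ∑-zero configs (λ φ → eq (σ , φ)))

    when-∑C : ∀ b (G : Config n → Carrier) → when b (∑C G) ≈ ∑C (λ x → when b (G x))
    when-∑C b G = trans (when-∑ configs b _) (∑-cong configs (λ σ → when-∑ configs b _))

    ∑C-δ : ∀ z (G : Config n → Carrier) → ∑C (λ x → when (eqConfig x z) (G x)) ≈ G z
    ∑C-δ (z₁ , z₂) G = begin
      ∑ configs (λ σ → ∑ configs (λ φ → when (eqVec σ z₁ ∧ eqVec φ z₂) (G (σ , φ))))
        ≈⟨ ∑-cong configs (λ σ → trans (∑-cong configs (λ φ → reflexive (≡-sym (when-when (eqVec σ z₁) (eqVec φ z₂) _))))
                                        (sym (when-∑ configs (eqVec σ z₁) _))) ⟩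
      ∑ configs (λ σ → when (eqVec σ z₁) (∑ configs (λ φ → when (eqVec φ z₂) (G (σ , φ)))))
        ≈⟨ ∑-cong configs (λ σ → when-cong (eqVec σ z₁) (∑-vecsOf-δ n z₂ (λ φ → G (σ , φ)))) ⟩
      ∑ configs (λ σ → when (eqVec σ z₁) (G (σ , z₂))) ≈⟨ ∑-vecsOf-δ n z₁ (λ σ → G (σ , z₂)) ⟩
      G (z₁ , z₂) ∎

    ∑C-swap : ∀ (G : Config n → Config n → Carrier) → ∑C (λ y → ∑C (λ x → G x y)) ≈ ∑C (λ x → ∑C (λ y → G x y))
    ∑C-swap G = begin
      ∑ configs (λ σy → ∑ configs (λ φy → ∑ configs (λ σx → ∑ configs (λ φx → G (σx , φx) (σy , φy)))))
        ≈⟨ ∑-cong configs (λ σy → ∑-swap configs configs _) ⟩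
      ∑ configs (λ σy → ∑ configs (λ σx → ∑ configs (λ φy → ∑ configs (λ φx → G (σx , φx) (σy , φy)))))
        ≈⟨ ∑-cong configs (λ σy → ∑-cong configs (λ σx → ∑-swap configs configs _)) ⟩
      ∑ configs (λ σy → ∑ configs (λ σx → ∑ configs (λ φx → ∑ configs (λ φy → G (σx , φx) (σy , φy)))))
        ≈⟨ ∑-swap configs configs _ ⟩
      ∑ configs (λ σx → ∑ configs (λ σy → ∑ configs (λ φx → ∑ configs (λ φy → G (σx , φx) (σy , φy)))))
        ≈⟨ ∑-cong configs (λ σx → ∑-swap configs configs _) ⟩
      ∑ configs (λ σx → ∑ configs (λ φx → ∑ configs (λ σy → ∑ configs (λ φy → G (σx , φx) (σy , φy))))) ∎

    ∑C-∑ : ∀ {a} {Y : Set a} (ys : List Y) (G : Config n → Y → Carrier) → ∑C (λ x → ∑ ys (λ j → G x j)) ≈ ∑ ys (λ j → ∑C (λ x → G x j))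
    ∑C-∑ ys G = trans (∑-cong configs (λ σ → ∑-swap configs ys _)) (∑-swap configs ys _)

    ∑C-reindex : ∀ (Pp Qp : Config n → Bool) (k k′ : Config n → Config n) →
      (∀ y → Qp y ≡ true → (Pp (k y) ≡ true) × (k′ (k y) ≡ y)) →
      (∀ x → Pp x ≡ true → (Qp (k′ x) ≡ true) × (k (k′ x) ≡ x)) →
      ∀ (G : Config n → Carrier) → ∑C (λ x → when (Pp x) (G x)) ≈ ∑C (λ y → when (Qp y) (G (k y)))
    ∑C-reindex Pp Qp k k′ kQ kP G = sym (begin
      ∑C (λ y → when (Qp y) (G (k y))) ≈⟨ ∑C-cong (λ y → when-cong (Qp y) (sym (∑C-δ (k y) G))) ⟩
      ∑C (λ y → when (Qp y) (∑C (λ x → when (eqConfig x (k y)) (G x)))) ≈⟨ ∑C-cong (λ y → when-∑C (Qp y) _) ⟩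
      ∑C (λ y → ∑C (λ x → when (Qp y) (when (eqConfig x (k y)) (G x))))
        ≈⟨ ∑C-swap (λ x y → when (Qp y) (when (eqConfig x (k y)) (G x))) ⟩
      ∑C (λ x → ∑C (λ y → when (Qp y) (when (eqConfig x (k y)) (G x))))
        ≈⟨ ∑C-cong (λ x → ∑C-cong (λ y → reflexive (≡-trans (when-when (Qp y) _ _)
             (≡-trans (≡-cong (λ b → when b (G x)) (same-pairs x y)) (≡-sym (when-when (Pp x) _ _)))))) ⟩
      ∑C (λ x → ∑C (λ y → when (Pp x) (when (eqConfig y (k′ x)) (G x)))) ≈⟨ ∑C-cong (λ x → sym (when-∑C (Pp x) _)) ⟩
      ∑C (λ x → when (Pp x) (∑C (λ y → when (eqConfig y (k′ x)) (G x))))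
        ≈⟨ ∑C-cong (λ x → when-cong (Pp x) (∑C-δ (k′ x) (λ _ → G x))) ⟩
      ∑C (λ x → when (Pp x) (G x)) ∎)
      where
      same-pairs : ∀ x y → (Qp y ∧ eqConfig x (k y)) ≡ (Pp x ∧ eqConfig y (k′ x))
      same-pairs x y with Qp y in qy | eqConfig x (k y) in e1
      ... | true | true with eqConfig-sound {x} {k y} e1
      ...   | ≡-refl with kQ y qy
      ...     | (pk , kk) rewrite pk | kk = ≡-sym (eqConfig-refl y)
      same-pairs x y | true | false with Pp x in px | eqConfig y (k′ x) in e2
      ... | true | true with eqConfig-sound {y} {k′ x} e2
      ...   | ≡-refl with kP x px
      ...     | (_ , kk) rewrite kk | eqConfig-refl x = ⊥-elim (true≢false e1)
      same-pairs x y | true | false | true | false = ≡-refl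
      same-pairs x y | true | false | false | _ = ≡-refl
      same-pairs x y | false | e with Pp x in px | eqConfig y (k′ x) in e2
      ... | true | true with eqConfig-sound {y} {k′ x} e2
      ...   | ≡-refl with kP x px
      ...     | (qk , _) rewrite qk = ⊥-elim (true≢false qy)
      same-pairs x y | false | e | true | false = ≡-refl
      same-pairs x y | false | e | false | _ = ≡-refl

    ∑C-cancel : ∀ (Pp Qp : Config n → Bool) (k k′ : Config n → Config n) →
      (∀ y → Qp y ≡ true → (Pp (k y) ≡ true) × (k′ (k y) ≡ y)) →
      (∀ x → Pp x ≡ true → (Qp (k′ x) ≡ true) × (k (k′ x) ≡ x)) →
      ∀ (F G : Config n → Carrier) → (∀ y → Qp y ≡ true → F (k y) ≈ - G y) →
      ∑C (λ x → when (Pp x) (F x)) + ∑C (λ y → when (Qp y) (G y)) ≈ 0#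
    ∑C-cancel Pp Qp k k′ kQ kP F G F∘k≈-G = begin
      ∑C (λ x → when (Pp x) (F x)) + ∑C (λ y → when (Qp y) (G y))       ≈⟨ +-cong (∑C-reindex Pp Qp k k′ kQ kP F) refl ⟩
      ∑C (λ y → when (Qp y) (F (k y))) + ∑C (λ y → when (Qp y) (G y))   ≈⟨ sym (∑C-+ _ _) ⟩
      ∑C (λ y → when (Qp y) (F (k y)) + when (Qp y) (G y))              ≈⟨ ∑C-zero pairs-cancel ⟩
      0#                                                                 ∎
      where
      pairs-cancel : ∀ y → when (Qp y) (F (k y)) + when (Qp y) (G y) ≈ 0#
      pairs-cancel y with Qp y in q
      ... | true = trans (+-cong (F∘k≈-G y q) refl) (-‿inverseˡ _)
      ... | false = +-identityˡ 0#

module SplittingAtThreshold {c ℓ} (R : CommutativeRing c ℓ) where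
  open CommutativeRing R
  open import Relation.Binary.Reasoning.Setoid setoid
  open P using (_≡_) renaming (refl to ≡-refl; sym to ≡-sym; trans to ≡-trans; cong to ≡-cong; cong₂ to ≡-cong₂)
  open DifferentialOperators R
  open NormalOrdering R
  open CapelliCommutation R

  module _ {n : ℕ} where
    outer : FinMap n → List (Fin n) → Poly R n → Poly R n
    outer σ [] g = g
    outer σ (i ∷ hs) g = outer σ hs (SigmaOp R (lookup σ i) i g)

    foldl-outer : ∀ σ hs (inner : Op R n) f →
                  foldl (λ acc i → SigmaOp R (lookup σ i) i ∘ acc) inner hs f ≡ outer σ hs (inner f)
    foldl-outer σ [] inner f = ≡-refl
    foldl-outer σ (i ∷ hs) inner f = foldl-outer σ hs (SigmaOp R (lookup σ i) i ∘ inner) f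

    SigmaConf≡outer : ∀ σ φ m f → SigmaConf R σ φ m f ≡
      outer σ (filterᵇ (λ i → ⌊ m ℕ.≤? suc (toℕ i) ⌋) (filterᵇ (keep σ φ) (allFin n)))
        (N (pairsOf (lookup σ) (filterᵇ (λ i → ⌊ suc (toℕ i) ℕ.<? m ⌋) (filterᵇ (keep σ φ) (allFin n)))) f)
    SigmaConf≡outer σ φ m = foldl-outer σ (filterᵇ (λ i → ⌊ m ℕ.≤? suc (toℕ i) ⌋) (filterᵇ (keep σ φ) (allFin n)))
      (N (pairsOf (lookup σ) (filterᵇ (λ i → ⌊ suc (toℕ i) ℕ.<? m ⌋) (filterᵇ (keep σ φ) (allFin n)))))

    outer-linear : ∀ σ hs → IsLinear (outer σ hs)
    outer-linear σ [] = id-linear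
    outer-linear σ (i ∷ hs) = ∘-linear (outer-linear σ hs) (SigmaOp-linear (lookup σ i) i)

    outer-agree : ∀ σ σ′ hs g → All (λ i → lookup σ′ i ≡ lookup σ i) hs → outer σ′ hs g ≡ outer σ hs g
    outer-agree σ σ′ [] g [] = ≡-refl
    outer-agree σ σ′ (i ∷ hs) g (σ′i≡σi ∷ rest) rewrite σ′i≡σi = outer-agree σ σ′ hs _ rest

  module AtThreshold {n : ℕ} (μF : Fin n) where
    open Threshold μF

    aboveTest belowTest : ℕ → Fin n → Bool
    aboveTest m i = ⌊ m ℕ.≤? suc (toℕ i) ⌋
    belowTest m i = ⌊ suc (toℕ i) ℕ.<? m ⌋

    private
      below-above₀ : All (λ i → aboveTest m₀ i ≡ false) below
      below-above₀ = All.map (λ i<μ → ⌊⌋-false (m₀ ℕ.≤? _) (λ le → NP.<⇒≱ i<μ (NP.≤-pred le))) below<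
      below-below₀ : All (λ i → belowTest m₀ i ≡ true) below
      below-below₀ = All.map (λ i<μ → ⌊⌋-true (_ ℕ.<? m₀) (s≤s i<μ)) below<
      below-above₁ : All (λ i → aboveTest m₁ i ≡ false) below
      below-above₁ = All.map (λ i<μ → ⌊⌋-false (m₁ ℕ.≤? _) (λ le → NP.<⇒≱ i<μ (NP.≤-trans (NP.n≤1+n μ) (NP.≤-pred le)))) below<
      below-below₁ : All (λ i → belowTest m₁ i ≡ true) below
      below-below₁ = All.map (λ i<μ → ⌊⌋-true (_ ℕ.<? m₁) (s≤s (NP.≤-trans i<μ (NP.n≤1+n μ)))) below<
      above-above₀ : ∀ {xs} → All (λ i → μ < toℕ i) xs → All (λ i → aboveTest m₀ i ≡ true) xs
      above-above₀ = All.map (λ μ<i → ⌊⌋-true (m₀ ℕ.≤? _) (s≤s (NP.<⇒≤ μ<i)))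
      above-below₀ : ∀ {xs} → All (λ i → μ < toℕ i) xs → All (λ i → belowTest m₀ i ≡ false) xs
      above-below₀ = All.map (λ μ<i → ⌊⌋-false (_ ℕ.<? m₀) (λ le → NP.<⇒≱ μ<i (NP.<⇒≤ (NP.≤-pred le))))
      above-above₁ : ∀ {xs} → All (λ i → μ < toℕ i) xs → All (λ i → aboveTest m₁ i ≡ true) xs
      above-above₁ = All.map (λ μ<i → ⌊⌋-true (m₁ ℕ.≤? _) (s≤s μ<i))
      above-below₁ : ∀ {xs} → All (λ i → μ < toℕ i) xs → All (λ i → belowTest m₁ i ≡ false) xs
      above-below₁ = All.map (λ μ<i → ⌊⌋-false (_ ℕ.<? m₁) (λ le → NP.<⇒≱ μ<i (NP.≤-pred (NP.≤-pred le))))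

      keptAbove> : ∀ σ φ → All (λ i → μ < toℕ i) (keptAbove σ φ)
      keptAbove> σ φ = filterᵇ-All (keep σ φ) above>

      kept-split : ∀ σ φ → All (λ i → keep σ φ i ≡ true) below →
                   filterᵇ (keep σ φ) (allFin n) ≡ below ++ filterᵇ (keep σ φ) (μF ∷ above)
      kept-split σ φ keeps-below = ≡-trans (≡-cong (filterᵇ (keep σ φ)) allFin≡)
        (≡-trans (filterᵇ-++ (keep σ φ) below (μF ∷ above)) (≡-cong (_++ filterᵇ (keep σ φ) (μF ∷ above)) (filterᵇ-all (keep σ φ) keeps-below)))

    SigmaConf-kept : ∀ σ φ → All (λ i → keep σ φ i ≡ true) below → keep σ φ μF ≡ true → ∀ f →
      SigmaConf R σ φ m₀ f ≐ (λ e → SigmaConf R σ φ m₁ f e + outer σ (keptAbove σ φ) (contractions (lookup σ μF) μF (lookup σ) below f) e)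
    SigmaConf-kept σ φ keeps-below keeps-μ f e = begin
      SigmaConf R σ φ m₀ f e
        ≡⟨ ≡-cong (λ z → z e) (SigmaConf≡outer σ φ m₀ f) ⟩
      outer σ (filterᵇ (aboveTest m₀) kept) (N (pairsOf τ (filterᵇ (belowTest m₀) kept)) f) e
        ≡⟨ ≡-cong₂ (λ hs ls → outer σ hs (N (pairsOf τ ls) f) e) above₀ below₀ ⟩
      outer σ ks (SigmaOp R (τ μF) μF (N (pairsOf τ below) f)) e
        ≈⟨ cong≐ (outer-linear σ ks) (SigmaOp-normalOrd (τ μF) μF τ below below-Unique f) e ⟩
      outer σ ks (λ e → N ((τ μF , μF) ∷ pairsOf τ below) f e + C e) e
        ≈⟨ +-hom (outer-linear σ ks) (N ((τ μF , μF) ∷ pairsOf τ below) f) C e ⟩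
      outer σ ks (N ((τ μF , μF) ∷ pairsOf τ below) f) e + outer σ ks C e
        ≈⟨ +-cong (cong≐ (outer-linear σ ks) (λ e → sym (normalOrd-snoc (pairsOf τ below) (τ μF , μF) f e)) e) refl ⟩
      outer σ ks (N (pairsOf τ below ++ (τ μF , μF) ∷ []) f) e + outer σ ks C e
        ≡⟨ ≡-cong (_+ outer σ ks C e) (≡-cong₂ (λ hs ls → outer σ hs (N ls f) e) (≡-sym above₁)
                                        (≡-trans (≡-sym (LP.map-++ _ below (μF ∷ []))) (≡-cong (pairsOf τ) (≡-sym below₁)))) ⟩
      outer σ (filterᵇ (aboveTest m₁) kept) (N (pairsOf τ (filterᵇ (belowTest m₁) kept)) f) e + outer σ ks C e
        ≡⟨ ≡-cong (λ z → z e + outer σ ks C e) (≡-sym (SigmaConf≡outer σ φ m₁ f)) ⟩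
      SigmaConf R σ φ m₁ f e + outer σ ks C e ∎
      where
      τ = lookup σ
      kept = filterᵇ (keep σ φ) (allFin n)
      ks = keptAbove σ φ
      C = contractions (τ μF) μF τ below f
      kept≡ : kept ≡ below ++ μF ∷ ks
      kept≡ rewrite kept-split σ φ keeps-below | keeps-μ = ≡-refl
      above₀ : filterᵇ (aboveTest m₀) kept ≡ μF ∷ ks
      above₀ rewrite kept≡ | filterᵇ-++ (aboveTest m₀) below (μF ∷ ks) | filterᵇ-none (aboveTest m₀) below-above₀
                   | ⌊⌋-true (m₀ ℕ.≤? suc μ) NP.≤-refl = ≡-cong (μF ∷_) (filterᵇ-all (aboveTest m₀) (above-above₀ (keptAbove> σ φ)))
      below₀ : filterᵇ (belowTest m₀) kept ≡ below
      below₀ rewrite kept≡ | filterᵇ-++ (belowTest m₀) below (μF ∷ ks) | filterᵇ-all (belowTest m₀) below-below₀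
                   | ⌊⌋-false (suc μ ℕ.<? m₀) (NP.<-irrefl ≡-refl) | filterᵇ-none (belowTest m₀) (above-below₀ (keptAbove> σ φ)) = LP.++-identityʳ below
      above₁ : filterᵇ (aboveTest m₁) kept ≡ ks
      above₁ rewrite kept≡ | filterᵇ-++ (aboveTest m₁) below (μF ∷ ks) | filterᵇ-none (aboveTest m₁) below-above₁
                   | ⌊⌋-false (m₁ ℕ.≤? suc μ) (λ le → NP.<-irrefl ≡-refl (NP.≤-pred le)) = filterᵇ-all (aboveTest m₁) (above-above₁ (keptAbove> σ φ))
      below₁ : filterᵇ (belowTest m₁) kept ≡ below ++ μF ∷ []
      below₁ rewrite kept≡ | filterᵇ-++ (belowTest m₁) below (μF ∷ ks) | filterᵇ-all (belowTest m₁) below-below₁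
                   | ⌊⌋-true (suc μ ℕ.<? m₁) NP.≤-refl | filterᵇ-none (belowTest m₁) (above-below₁ (keptAbove> σ φ)) = ≡-refl

    SigmaConf-dropped : ∀ σ φ → All (λ i → keep σ φ i ≡ true) below → keep σ φ μF ≡ false → ∀ f →
      SigmaConf R σ φ m₀ f ≐ outer σ (keptAbove σ φ) (N (pairsOf (lookup σ) below) f)
    SigmaConf-dropped σ φ keeps-below drops-μ f e = reflexive (≡-trans (≡-cong (λ z → z e) (SigmaConf≡outer σ φ m₀ f))
        (≡-cong₂ (λ hs ls → outer σ hs (N (pairsOf (lookup σ) ls) f) e) above₀ below₀))
      where
      kept = filterᵇ (keep σ φ) (allFin n)
      ks = keptAbove σ φ
      kept≡ : kept ≡ below ++ ks
      kept≡ rewrite kept-split σ φ keeps-below | drops-μ = ≡-refl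
      above₀ : filterᵇ (aboveTest m₀) kept ≡ ks
      above₀ rewrite kept≡ | filterᵇ-++ (aboveTest m₀) below ks | filterᵇ-none (aboveTest m₀) below-above₀ =
        filterᵇ-all (aboveTest m₀) (above-above₀ (keptAbove> σ φ))
      below₀ : filterᵇ (belowTest m₀) kept ≡ below
      below₀ rewrite kept≡ | filterᵇ-++ (belowTest m₀) below ks | filterᵇ-all (belowTest m₀) below-below₀
                   | filterᵇ-none (belowTest m₀) (above-below₀ (keptAbove> σ φ)) = LP.++-identityʳ below

module Cancellation {c ℓ} (R : CommutativeRing c ℓ) where
  open CommutativeRing R
  open import Relation.Binary.Reasoning.Setoid setoid
  open import Algebra.Properties.Ring ring using (-‿distribˡ-*; -‿involutive)
  open P using (_≡_) renaming (refl to ≡-refl; sym to ≡-sym; trans to ≡-trans; cong to ≡-cong; cong₂ to ≡-cong₂)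
  open FiniteSums R
  open DifferentialOperators R
  open SymmetricVariables R
  open NormalOrdering R
  open CapelliCommutation R
  open ConfigurationSums R
  open SplittingAtThreshold R

  sign-swapPositions : ∀ {n} (σ : FinMap n) → Injective _≡_ _≡_ (lookup σ) → ∀ j μ (j<μ : toℕ j < toℕ μ) →
                       sign R (Transposition.swapPositions j μ j<μ σ) ≈ - sign R σ
  sign-swapPositions σ σ-inj j μ j<μ
    rewrite even-test≡not-odd (inversions (Transposition.swapPositions j μ j<μ σ))
          | Transposition.odd-inversions-swapPositions j μ j<μ σ σ-inj
          | even-test≡not-odd (inversions σ) with odd (inversions σ)
  ... | true = sym (-‿involutive 1#)
  ... | false = refl

  capelliSum≡∑C : ∀ n m f e → capelliSum R n m f e ≈
                  ∑C (λ (σ , φ) → when (memberC m σ φ) (sign R σ * SigmaConf R σ φ m f e))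
  capelliSum≡∑C n m f e = sumR-concatMap _ (vecsOf (allFin n) n)

  module _ {n : ℕ} (μF : Fin n) (f : Poly R n) (e : Mon n) where
    open Threshold μF
    open AtThreshold μF

    leaving : FinMap n → FinMap n → Bool
    leaving σ φ = memberC m₀ σ φ ∧ not (memberC m₁ σ φ)

    contractionTerm droppedTerm : FinMap n → FinMap n → Carrier
    contractionTerm σ φ = outer σ (keptAbove σ φ) (contractions (lookup σ μF) μF (lookup σ) below f) e
    droppedTerm σ φ = outer σ (keptAbove σ φ) (N (pairsOf (lookup σ) below) f) e

    decompose : ∀ σ φ → when (memberC m₀ σ φ) (sign R σ * SigmaConf R σ φ m₀ f e) ≈
      when (memberC m₁ σ φ) (sign R σ * SigmaConf R σ φ m₁ f e) +
      (when (memberC m₁ σ φ) (sign R σ * contractionTerm σ φ) + when (leaving σ φ) (sign R σ * droppedTerm σ φ))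
    decompose σ φ with memberC m₁ σ φ in in₁
    ... | true rewrite memberC-complete m₀ σ φ (InC-antitone (NP.n≤1+n m₀) (memberC-sound m₁ σ φ in₁)) = begin
        sign R σ * SigmaConf R σ φ m₀ f e
          ≈⟨ *-congˡ (SigmaConf-kept σ φ (InC-keep-below (InC-antitone (NP.n≤1+n m₀) c₁)) (InC-keep-μ c₁) f e) ⟩
        sign R σ * (SigmaConf R σ φ m₁ f e + contractionTerm σ φ)          ≈⟨ distribˡ _ _ _ ⟩
        sign R σ * SigmaConf R σ φ m₁ f e + sign R σ * contractionTerm σ φ ≈⟨ +-cong refl (sym (+-identityʳ _)) ⟩
        sign R σ * SigmaConf R σ φ m₁ f e + (sign R σ * contractionTerm σ φ + 0#) ∎
      where c₁ = memberC-sound m₁ σ φ in₁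
    ... | false with memberC m₀ σ φ in in₀
    ...   | true = begin
        sign R σ * SigmaConf R σ φ m₀ f e
          ≈⟨ *-congˡ (SigmaConf-dropped σ φ (InC-keep-below c₀) (drop-μ {σ} {φ} (proj₁ leaves) (proj₂ leaves)) f e) ⟩
        sign R σ * droppedTerm σ φ               ≈⟨ sym (trans (+-identityˡ _) (+-identityˡ _)) ⟩
        0# + (0# + sign R σ * droppedTerm σ φ)   ∎
      where c₀ = memberC-sound m₀ σ φ in₀
            leaves = C[m₀]-C[m₁] c₀ (memberC-leaving {σ} {φ} in₀ in₁)
    ...   | false = sym (trans (+-identityˡ _) (+-identityˡ _))

    mergedProduct crossProduct : FinMap n → Fin n → Poly R n
    mergedProduct σ j = N (pairsOf (redirect (lookup σ) j (lookup σ μF)) below) f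
    crossProduct σ j e′ = coef R j μF * X (lookup σ μF) (lookup σ j) (N (pairsOf (lookup σ) (without j below)) (D j μF f)) e′

    merged crossed leavingAt : Fin n → Config n → Carrier
    merged j (σ , φ) = when (memberC m₁ σ φ) (sign R σ * when (eqF μF (lookup σ j)) (outer σ (keptAbove σ φ) (mergedProduct σ j) e))
    crossed j (σ , φ) = when (memberC m₁ σ φ) (sign R σ * outer σ (keptAbove σ φ) (crossProduct σ j) e)
    leavingAt j (σ , φ) = when (leaving σ φ ∧ eqF j (lookup φ μF)) (sign R σ * droppedTerm σ φ)

    contractionTerm-by-position : ∀ σ φ → when (memberC m₁ σ φ) (sign R σ * contractionTerm σ φ) ≈
                                  ∑ below (λ j → merged j (σ , φ) + crossed j (σ , φ))
    contractionTerm-by-position σ φ = begin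
      when c₁ (sign R σ * contractionTerm σ φ)                      ≈⟨ when-cong c₁ (*-congˡ expand) ⟩
      when c₁ (sign R σ * ∑ below (λ j → Y₁ j + Y₂ j))              ≈⟨ when-cong c₁ (*-∑ below _ _) ⟩
      when c₁ (∑ below (λ j → sign R σ * (Y₁ j + Y₂ j)))            ≈⟨ when-∑ below c₁ _ ⟩
      ∑ below (λ j → when c₁ (sign R σ * (Y₁ j + Y₂ j)))
        ≈⟨ ∑-cong below (λ j → trans (when-cong c₁ (distribˡ _ _ _)) (when-+ c₁ _ _)) ⟩
      ∑ below (λ j → merged j (σ , φ) + crossed j (σ , φ))          ∎
      where
      c₁ = memberC m₁ σ φ
      L = outer-linear σ (keptAbove σ φ)
      Y₁ Y₂ : Fin n → Carrier
      Y₁ j = when (eqF μF (lookup σ j)) (outer σ (keptAbove σ φ) (mergedProduct σ j) e)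
      Y₂ j = outer σ (keptAbove σ φ) (crossProduct σ j) e
      expand : contractionTerm σ φ ≈ ∑ below (λ j → Y₁ j + Y₂ j)
      expand = trans (∑-hom L below _ e) (∑-cong below (λ j → trans (+-hom L _ _ e) (+-cong (when-hom L _ _ e) refl)))

    ∑-below-δ : ∀ z → toℕ z < μ → ∀ Y → ∑ below (λ j → when (eqF j z) Y) ≈ Y
    ∑-below-δ z z<μ Y = begin
      ∑ below g                   ≈⟨ sym (+-identityʳ _) ⟩
      ∑ below g + 0#
        ≈⟨ +-cong refl (sym (trans (+-cong (reflexive (≡-cong (λ b → when b Y) (eqF-≢ μ≢z))) above-vanish) (+-identityˡ 0#))) ⟩
      ∑ below g + (g μF + ∑ above g) ≈⟨ sym (∑-++ below (μF ∷ above) g) ⟩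
      ∑ (below ++ μF ∷ above) g   ≡⟨ ≡-cong (λ l → ∑ l g) (≡-sym allFin≡) ⟩
      ∑ (allFin n) g              ≈⟨ ∑-δ z (λ _ → Y) ⟩
      Y                           ∎
      where
      g : Fin n → Carrier
      g j = when (eqF j z) Y
      μ≢z : μF ≢ z
      μ≢z μ≡z = NP.<-irrefl (≡-cong toℕ (≡-sym μ≡z)) z<μ
      above-vanish : ∑ above g ≈ 0#
      above-vanish = trans (∑-congᴬ (All.map (λ μ<i → reflexive (≡-cong (λ b → when b Y)
        (eqF-≢ (λ i≡z → NP.<-asym z<μ (P.subst (λ w → μ < toℕ w) i≡z μ<i))))) above>)) (∑-zero above (λ _ → refl))

    droppedTerm-by-position : ∀ σ φ → when (leaving σ φ) (sign R σ * droppedTerm σ φ) ≈ ∑ below (λ j → leavingAt j (σ , φ))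
    droppedTerm-by-position σ φ with memberC m₀ σ φ in in₀ | memberC m₁ σ φ in in₁
    ... | true | false = sym (∑-below-δ (lookup φ μF)
                                (proj₂ (C[m₀]-C[m₁] (memberC-sound m₀ σ φ in₀) (memberC-leaving {σ} {φ} in₀ in₁))) _)
    ... | true | true = sym (∑-zero below (λ _ → refl))
    ... | false | _ = sym (∑-zero below (λ _ → refl))

    module AtPosition (j : Fin n) (j<μ : toℕ j < μ) where
      open Involutions j j<μ

      outer-swapped : ∀ {σ φ σ′ φ′ : FinMap n} → (∀ {i} → i ≢ j → i ≢ μF → lookup σ′ i ≡ lookup σ i) →
                      (∀ {i} → i ≢ j → i ≢ μF → lookup φ′ i ≡ lookup φ i) →
                      ∀ g → outer σ′ (keptAbove σ′ φ′) g ≡ outer σ (keptAbove σ φ) g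
      outer-swapped {σ} {φ} {σ′} {φ′} σ-agree φ-agree g =
        ≡-trans (≡-cong (λ hs → outer σ′ hs g) (keptAbove-agree {σ} {φ} {σ′} {φ′} σ-agree φ-agree))
                (outer-agree σ σ′ (keptAbove σ φ) g (σ-agree-keptAbove {σ} {φ} {σ′} {φ′} σ-agree φ-agree))

      outer-swapReset : ∀ σ φ g → outer (swapPositions σ) (keptAbove (swapPositions σ) (resetφ σ φ)) g ≡ outer σ (keptAbove σ φ) g
      outer-swapReset σ φ = outer-swapped {σ} {φ} {swapPositions σ} {resetφ σ φ} (swapPositions-other σ) (resetφ-other σ φ)

      mergedSide leavingSide : Config n → Bool
      mergedSide (σ , φ) = memberC m₁ σ φ ∧ eqF μF (lookup σ j)
      leavingSide (σ , φ) = leaving σ φ ∧ eqF j (lookup φ μF)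

      mergedValue leavingValue : Config n → Carrier
      mergedValue (σ , φ) = sign R σ * outer σ (keptAbove σ φ) (mergedProduct σ j) e
      leavingValue (σ , φ) = sign R σ * droppedTerm σ φ

      leaving→merged : ∀ y → leavingSide y ≡ true → (mergedSide (swapReset y) ≡ true) × (swapMark (swapReset y) ≡ y)
      leaving→merged (σ , φ) q with ∧-true⁻ q
      ... | (lv , φμ≡j) with ∧-true⁻ {memberC m₀ σ φ} lv
      ...   | (in₀ , out₁) =
        ∧-true⁺ (memberC-complete m₁ _ _ (InC-swapReset c₀)) (eqF-≡ (≡-sym (≡-trans (swapPositions-j σ) (proj₁ leaves))))
        , swapMark-swapReset c₀ (≡-sym (eqF-sound φμ≡j))
        where
        c₀ = memberC-sound m₀ σ φ in₀
        leaves = C[m₀]-C[m₁] c₀ (memberC-leaving {σ} {φ} in₀ (not-true out₁))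

      merged→leaving : ∀ x → mergedSide x ≡ true → (leavingSide (swapMark x) ≡ true) × (swapReset (swapMark x) ≡ x)
      merged→leaving (σ , φ) p with ∧-true⁻ p
      ... | (in₁ , μ≡σj) = is-leaving , swapReset-swapMark c₁
        where
        c₁ = memberC-sound m₁ σ φ in₁
        σj≡μ = ≡-sym (eqF-sound μ≡σj)
        is-leaving : leavingSide (swapMark (σ , φ)) ≡ true
        is-leaving rewrite memberC-complete m₀ _ _ (InC-swapMark c₁ σj≡μ) | swapMark-∉C[m₁] {σ} {φ} σj≡μ | markφ-μ σ φ = eqF-refl j

      mergedValue-swapReset : ∀ y → leavingSide y ≡ true → mergedValue (swapReset y) ≈ - leavingValue y
      mergedValue-swapReset (σ , φ) q = begin
        sign R (swapPositions σ) * outer (swapPositions σ) (keptAbove (swapPositions σ) (resetφ σ φ)) (mergedProduct (swapPositions σ) j) e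
          ≈⟨ *-cong (sign-swapPositions σ (InC.injective c₀) j μF j<μ)
                    (reflexive (≡-cong (λ z → z e) (outer-swapReset σ φ _))) ⟩
        - sign R σ * outer σ (keptAbove σ φ) (mergedProduct (swapPositions σ) j) e
          ≡⟨ ≡-cong (λ L → - sign R σ * outer σ (keptAbove σ φ) (N L f) e) unmerged ⟩
        - sign R σ * droppedTerm σ φ   ≈⟨ sym (-‿distribˡ-* _ _) ⟩
        - leavingValue (σ , φ)         ∎
        where
        c₀ = memberC-sound m₀ σ φ (proj₁ (∧-true⁻ (proj₁ (∧-true⁻ q))))
        σ′ = lookup (swapPositions σ)
        unmerged : pairsOf (redirect σ′ j (σ′ μF)) below ≡ pairsOf (lookup σ) below
        unmerged = pairsOf-cong below (All.map (λ {i} i<μ → at i i<μ) below<)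
          where
          at : ∀ i → toℕ i < μ → redirect σ′ j (σ′ μF) i ≡ lookup σ i
          at i i<μ with i ≟F j
          ... | yes ≡-refl = swapPositions-μ σ
          ... | no i≢j = swapPositions-other σ i≢j (λ i≡μ → NP.<-irrefl (≡-cong toℕ i≡μ) i<μ)

      merged-leaving-cancel : ∑C (merged j) + ∑C (leavingAt j) ≈ 0#
      merged-leaving-cancel = begin
        ∑C (merged j) + ∑C (leavingAt j)
          ≈⟨ +-cong (∑C-cong (λ (σ , φ) → trans (when-cong (memberC m₁ σ φ) (*-when (eqF μF (lookup σ j)) _ _))
                                                (reflexive (when-when (memberC m₁ σ φ) _ _)))) refl ⟩
        ∑C (λ x → when (mergedSide x) (mergedValue x)) + ∑C (λ y → when (leavingSide y) (leavingValue y))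
          ≈⟨ ∑C-cancel mergedSide leavingSide swapReset swapMark leaving→merged merged→leaving mergedValue leavingValue mergedValue-swapReset ⟩
        0# ∎

      descentSide ascentSide : Config n → Bool
      descentSide (σ , φ) = memberC m₁ σ φ ∧ ltF (lookup σ μF) (lookup σ j)
      ascentSide (σ , φ) = memberC m₁ σ φ ∧ ltF (lookup σ j) (lookup σ μF)

      crossValue : Config n → Carrier
      crossValue (σ , φ) = sign R σ * outer σ (keptAbove σ φ) (crossProduct σ j) e

      crossed-split : ∀ x → crossed j x ≈ when (descentSide x) (crossValue x) + when (ascentSide x) (crossValue x)
      crossed-split (σ , φ) with memberC m₁ σ φ in in₁
      ... | false = sym (+-identityˡ 0#)
      ... | true rewrite ltF-flip {i = lookup σ μF} {lookup σ j} (λ σμ≡σj → μ≢j (InC.injective (memberC-sound m₁ σ φ in₁) σμ≡σj))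
          with ltF (lookup σ μF) (lookup σ j)
      ...   | true = sym (+-identityʳ _)
      ...   | false = sym (+-identityˡ _)

      swapReset-flips : ∀ {σ φ} (s₁ s₂ : FinMap n → Bool) → memberC m₁ σ φ ∧ s₁ σ ≡ true →
                        s₂ (swapPositions σ) ≡ s₁ σ →
                        (memberC m₁ (swapPositions σ) (resetφ σ φ) ∧ s₂ (swapPositions σ) ≡ true)
                        × (swapReset (swapReset (σ , φ)) ≡ (σ , φ))
      swapReset-flips {σ} {φ} s₁ s₂ p s₂≡s₁ with ∧-true⁻ p
      ... | (in₁ , s₁σ) = ∧-true⁺ (memberC-complete m₁ _ _ (InC-swapReset (InC-antitone (NP.n≤1+n m₀) c₁))) (≡-trans s₂≡s₁ s₁σ)
                        , swapReset-involutive c₁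
        where c₁ = memberC-sound m₁ σ φ in₁

      ascent→descent : ∀ y → ascentSide y ≡ true → (descentSide (swapReset y) ≡ true) × (swapReset (swapReset y) ≡ y)
      ascent→descent (σ , φ) q = swapReset-flips (λ σ → ltF (lookup σ j) (lookup σ μF)) (λ σ → ltF (lookup σ μF) (lookup σ j)) q
        (≡-cong₂ ltF (swapPositions-μ σ) (swapPositions-j σ))

      descent→ascent : ∀ x → descentSide x ≡ true → (ascentSide (swapReset x) ≡ true) × (swapReset (swapReset x) ≡ x)
      descent→ascent (σ , φ) p = swapReset-flips (λ σ → ltF (lookup σ μF) (lookup σ j)) (λ σ → ltF (lookup σ j) (lookup σ μF)) p
        (≡-cong₂ ltF (swapPositions-j σ) (swapPositions-μ σ))

      crossValue-swapReset : ∀ y → ascentSide y ≡ true → crossValue (swapReset y) ≈ - crossValue y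
      crossValue-swapReset (σ , φ) q = begin
        sign R (swapPositions σ) * outer (swapPositions σ) (keptAbove (swapPositions σ) (resetφ σ φ)) (crossProduct (swapPositions σ) j) e
          ≈⟨ *-cong (sign-swapPositions σ (InC.injective c₁) j μF j<μ) (reflexive (≡-cong (λ z → z e) (outer-swapReset σ φ _))) ⟩
        - sign R σ * outer σ (keptAbove σ φ) (crossProduct (swapPositions σ) j) e
          ≈⟨ *-congˡ (cong≐ (outer-linear σ (keptAbove σ φ)) same-cross e) ⟩
        - sign R σ * outer σ (keptAbove σ φ) (crossProduct σ j) e ≈⟨ sym (-‿distribˡ-* _ _) ⟩
        - crossValue (σ , φ) ∎
        where
        c₁ = memberC-sound m₁ σ φ (proj₁ (∧-true⁻ q))
        agree-without-j : All (λ i → lookup (swapPositions σ) i ≡ lookup σ i) (without j below)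
        agree-without-j = All.map (λ (i≢j , i<μ) → swapPositions-other σ i≢j (λ i≡μ → NP.<-irrefl (≡-cong toℕ i≡μ) i<μ))
                                  (without-All j below<)
        same-cross : crossProduct (swapPositions σ) j ≐ crossProduct σ j
        same-cross e′ rewrite swapPositions-μ σ | swapPositions-j σ | pairsOf-cong (without j below) agree-without-j =
          *-congˡ (reflexive (X-sym (lookup σ j) (lookup σ μF) _ e′))

      crossed-cancel : ∑C (crossed j) ≈ 0#
      crossed-cancel = begin
        ∑C (crossed j)
          ≈⟨ ∑C-cong crossed-split ⟩
        ∑C (λ x → when (descentSide x) (crossValue x) + when (ascentSide x) (crossValue x))
          ≈⟨ ∑C-+ (λ x → when (descentSide x) (crossValue x)) (λ x → when (ascentSide x) (crossValue x)) ⟩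
        ∑C (λ x → when (descentSide x) (crossValue x)) + ∑C (λ x → when (ascentSide x) (crossValue x))
          ≈⟨ ∑C-cancel descentSide ascentSide swapReset swapReset ascent→descent descent→ascent crossValue crossValue crossValue-swapReset ⟩
        0# ∎

    corrections-vanish : ∑C (λ (σ , φ) → when (memberC m₁ σ φ) (sign R σ * contractionTerm σ φ))
                       + ∑C (λ (σ , φ) → when (leaving σ φ) (sign R σ * droppedTerm σ φ)) ≈ 0#
    corrections-vanish = begin
      ∑C (λ (σ , φ) → when (memberC m₁ σ φ) (sign R σ * contractionTerm σ φ))
        + ∑C (λ (σ , φ) → when (leaving σ φ) (sign R σ * droppedTerm σ φ))
        ≈⟨ +-cong (trans (∑C-cong (λ (σ , φ) → contractionTerm-by-position σ φ))
                         (trans (∑C-∑ below (λ x j → merged j x + crossed j x)) (∑-cong below (λ j → ∑C-+ (merged j) (crossed j)))))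
                  (trans (∑C-cong (λ (σ , φ) → droppedTerm-by-position σ φ)) (∑C-∑ below (λ x j → leavingAt j x))) ⟩
      ∑ below (λ j → ∑C (merged j) + ∑C (crossed j)) + ∑ below (λ j → ∑C (leavingAt j))
        ≈⟨ sym (∑-+ below _ _) ⟩
      ∑ below (λ j → (∑C (merged j) + ∑C (crossed j)) + ∑C (leavingAt j))
        ≈⟨ ∑-congᴬ (All.map (λ {j} j<μ → at j j<μ) below<) ⟩
      ∑ below (λ _ → 0#)
        ≈⟨ ∑-zero below (λ _ → refl) ⟩
      0# ∎
      where
      at : ∀ j → toℕ j < μ → (∑C (merged j) + ∑C (crossed j)) + ∑C (leavingAt j) ≈ 0#
      at j j<μ = begin
        (∑C (merged j) + ∑C (crossed j)) + ∑C (leavingAt j)   ≈⟨ +-assoc _ _ _ ⟩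
        ∑C (merged j) + (∑C (crossed j) + ∑C (leavingAt j))   ≈⟨ +-cong refl (+-comm _ _) ⟩
        ∑C (merged j) + (∑C (leavingAt j) + ∑C (crossed j))   ≈⟨ sym (+-assoc _ _ _) ⟩
        (∑C (merged j) + ∑C (leavingAt j)) + ∑C (crossed j)   ≈⟨ +-cong merged-leaving-cancel crossed-cancel ⟩
        0# + 0#                                               ≈⟨ +-identityˡ 0# ⟩
        0#                                                    ∎
        where open AtPosition j j<μ

    capelliSum-step : capelliSum R n m₁ f e ≈ capelliSum R n m₀ f e
    capelliSum-step = sym (begin
      capelliSum R n m₀ f e                    ≈⟨ capelliSum≡∑C n m₀ f e ⟩
      ∑C (λ (σ , φ) → when (memberC m₀ σ φ) (sign R σ * SigmaConf R σ φ m₀ f e))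
                                               ≈⟨ ∑C-cong (λ (σ , φ) → decompose σ φ) ⟩
      ∑C (λ x → stay x + (correct x + leave x)) ≈⟨ trans (∑C-+ stay _) (+-cong refl (∑C-+ correct leave)) ⟩
      ∑C stay + (∑C correct + ∑C leave)        ≈⟨ +-cong refl corrections-vanish ⟩
      ∑C stay + 0#                             ≈⟨ +-identityʳ _ ⟩
      ∑C stay                                  ≈⟨ sym (capelliSum≡∑C n m₁ f e) ⟩
      capelliSum R n m₁ f e                    ∎)
      where
      stay correct leave : Config n → Carrier
      stay (σ , φ) = when (memberC m₁ σ φ) (sign R σ * SigmaConf R σ φ m₁ f e)
      correct (σ , φ) = when (memberC m₁ σ φ) (sign R σ * contractionTerm σ φ)
      leave (σ , φ) = when (leaving σ φ) (sign R σ * droppedTerm σ φ)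

open Cancellation using (capelliSum-step)

-- The operators act coefficientwise.
mainTheorem3 : ∀ {c ℓ} (R : CommutativeRing c ℓ) (n m : ℕ) → 1 ≤ n → 1 ≤ m → m ≤ n →
    (f : Poly R n) → IsPoly R f → (e : Mon n) →
    CommutativeRing._≈_ R (capelliSum R n (suc m) f e) (capelliSum R n m f e)
mainTheorem3 R n (suc μ) _ (s≤s z≤n) m≤n f _ e =
  P.subst (λ k → CommutativeRing._≈_ R (capelliSum R n (suc (suc k)) f e) (capelliSum R n (suc k) f e))
    (toℕ-fromℕ< m≤n) (capelliSum-step R (F.fromℕ< m≤n) f e)
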